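{- For integers $t\ge 1$ and $s\ge 2$, the $\mathcal{H}$-spectrum of the complete split graph $K_t\vee(sK_1)$ consists of $s+t$ with multiplicity $\binom{t+1}{2}$ and $t$ with multiplicity $(s-1)t$.
   Context: $K_t\vee(sK_1)$ is the join of the complete graph $K_t$ with $s$ isolated vertices. Graphs are finite, simple and undirected. Fix an orientation of every edge (tail $e^-$, head $e^+$) and a cyclic orientation of every triangle. Let $\mathcal{B}$ be the $|E|\times|V|$ matrix with $b_{ev}=-1$ if $v=e^-$, $1$ if $v=e^+$, $0$ otherwise, and $\mathcal{C}$ the $|T|\times|E|$ matrix ($T$ the set of triangles) with $c_{\vartriangle e}=\pm1$ if $e$ is an edge of $\vartriangle$ (sign $+$ iff the orientation of $e$ agrees with that of $\vartriangle$) and $0$ otherwise. The Helmholtzian matrix is $\mathcal{H}(G)=\mathcal{B}\mathcal{B}^{\intercal}+\mathcal{C}^{\intercal}\mathcal{C}$; its spectrum (the $\mathcal{H}$-spectrum) does not depend on the chosen orientations. -}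

module Defs where

open import Data.Bool using (Bool; true; false; _∧_; _∨_; not; if_then_else_)
open import Data.Nat as ℕ using (ℕ; zero; suc; _<ᵇ_; _≡ᵇ_)
open import Data.Integer as ℤ using (ℤ; +_; -_; _+_; _*_; _-_; _^_)
open import Data.Fin using (Fin; toℕ; punchIn)
import Data.Fin
open import Data.Product using (_×_; _,_)
open import Data.List using (List; []; _∷_; map; concatMap; filterᵇ; allFin; length; lookup; foldr)

-- A finite simple graph on vertex set Fin n is given by
-- a (symmetric, irreflexive) Boolean adjacency function.  Only pairs
-- i < j are ever inspected, so every edge {i,j} is listed once.

record Graph : Set where
  field
    n   : ℕ
    adj : Fin n → Fin n → Bool
open Graph public

_==ᶠ_ : ∀ {n} → Fin n → Fin n → Bool
i ==ᶠ j = toℕ i ≡ᵇ toℕ j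

_<ᶠ_ : ∀ {n} → Fin n → Fin n → Bool
i <ᶠ j = toℕ i <ᵇ toℕ j

sumℤ : List ℤ → ℤ
sumℤ = foldr _+_ (+ 0)

-- Edges: pairs (i , j) with i < j adjacent.  Fixed orientation: tail i, head j.
Edges : (G : Graph) → List (Fin (n G) × Fin (n G))
Edges G = concatMap (λ i → map (λ j → (i , j))
            (filterᵇ (λ j → (i <ᶠ j) ∧ adj G i j) (allFin (n G)))) (allFin (n G))

-- Triangles: triples (i , j , k) with i < j < k pairwise adjacent.
-- Fixed cyclic orientation i → j → k → i.
Triangles : (G : Graph) → List (Fin (n G) × Fin (n G) × Fin (n G))
Triangles G = concatMap (λ i → concatMap (λ j → map (λ k → (i , j , k))
                (filterᵇ (λ k → (j <ᶠ k) ∧ adj G j k ∧ adj G i k) (allFin (n G))))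
                (filterᵇ (λ j → (i <ᶠ j) ∧ adj G i j) (allFin (n G)))) (allFin (n G))

m : Graph → ℕ
m G = length (Edges G)

bEntry : ∀ {k} → Fin k × Fin k → Fin k → ℤ
bEntry (i , j) v = if v ==ᶠ i then - (+ 1) else (if v ==ᶠ j then + 1 else + 0)

-- entry c_{△ e} of the triangle–edge matrix 𝓒 (|T| × |E|);
-- the edge i→j and j→k agree with i→j→k→i, the edge i→k disagrees.
cEntry : ∀ {k} → Fin k × Fin k × Fin k → Fin k × Fin k → ℤ
cEntry (i , j , k) (a , b) =
  if (a ==ᶠ i) ∧ (b ==ᶠ j) then + 1 else
  (if (a ==ᶠ j) ∧ (b ==ᶠ k) then + 1 else
  (if (a ==ᶠ i) ∧ (b ==ᶠ k) then - (+ 1) else + 0))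

Matrix : ℕ → Set
Matrix k = Fin k → Fin k → ℤ

-- The Helmholtzian  𝓗(G) = 𝓑 𝓑ᵀ + 𝓒ᵀ 𝓒, an |E| × |E| matrix.
Helmholtzian : (G : Graph) → Matrix (m G)
Helmholtzian G e f =
  sumℤ (map (λ v → bEntry (lookup (Edges G) e) v * bEntry (lookup (Edges G) f) v) (allFin (n G)))
  + sumℤ (map (λ T → cEntry T (lookup (Edges G) e) * cEntry T (lookup (Edges G) f)) (Triangles G))

det : (k : ℕ) → Matrix k → ℤ
det zero    M = + 1
det (suc k) M = sumℤ (map (λ j → ((- (+ 1)) ^ toℕ j) * M Data.Fin.zero j
                   * det k (λ r c → M (Data.Fin.suc r) (punchIn j c))) (allFin (suc k)))

charPolyAt : ∀ {k} → Matrix k → ℤ → ℤ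
charPolyAt {k} M x = det k (λ i j → (if i ==ᶠ j then x else + 0) - M i j)

-- The complete split graph K_t ∨ (s K_1): vertices Fin (t + s); the
-- first t vertices form the clique K_t, the last s are independent.

inClique : ∀ {t s} → Fin (t ℕ.+ s) → Bool
inClique {t} v = toℕ v <ᵇ t

completeSplit : ℕ → ℕ → Graph
completeSplit t s = record
  { n   = t ℕ.+ s
  ; adj = λ u v → not (u ==ᶠ v) ∧ (inClique {t} {s} u ∨ inClique {t} {s} v) }

-- Order the edges lexicographically, so that the edges with a common tail (smaller end) form
-- a block.  In K_t ∨ sK_1 the clique is {0, …, t − 1}, so every edge has its tail in the
-- clique.  Expanding 𝓗 = 𝓑𝓑ᵀ + 𝓒ᵀ𝓒 entrywise in Kronecker deltas and triangle indicators, two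
-- edges with different tails get entry 0 (when they meet, they span a triangle whose 𝓒ᵀ𝓒-term
-- cancels the 𝓑𝓑ᵀ-term), so x I − 𝓗 is block diagonal.  In the block of a tail p < t the
-- t − 1 − p edges to clique vertices are decoupled with diagonal entry t + s, while the s edges
-- to independent vertices form the block t I + J.  So the block contributes
-- (x − t − s)^(t − 1 − p) · (x − t − s) (x − t)^(s − 1), and ∑_{p < t} (t − p) = C(t + 1, 2).

module Submission where

open import Defs
open import Data.Nat using (ℕ; _≤_; _∸_) renaming (_+_ to _+ℕ_; _*_ to _*ℕ_)
open import Data.Nat.Combinatorics using (_C_)
open import Data.Integer using (ℤ; +_; _-_; _*_; _^_)
open import Relation.Binary.PropositionalEquality using (_≡_)

import Data.Nat as ℕ
open import Data.Nat using (zero; suc)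
import Data.Nat.Properties as ℕP
open import Data.Nat.Combinatorics using (nC1≡n; nCk+nC[k+1]≡[n+1]C[k+1])
open import Data.Integer using (-_; _+_; -[1+_])
import Data.Integer.Properties as ℤP
open import Data.Integer.Tactic.RingSolver using (solve-∀)
open import Data.Fin using (Fin; zero; suc; toℕ; punchIn; _↑ˡ_; _↑ʳ_; cast; _≟_)
import Data.Fin.Properties as FinP
open import Data.Bool using (Bool; true; false; if_then_else_; _∧_; _∨_; not)
open import Data.Bool.Properties using (T-≡; ∧-zeroʳ; ∨-zeroʳ)
open import Data.Empty using (⊥; ⊥-elim)
open import Data.Product using (_×_; _,_; proj₁; proj₂; ∃)
open import Data.Product.Properties using (≡-dec)
open import Data.Sum using (_⊎_; inj₁; inj₂; [_,_]′)
open import Data.Vec.Functional using () renaming (_∷_ to infixr 5 _◂_)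
open import Data.List using (List; []; _∷_; _++_; map; allFin; tabulate; concat; concatMap; filterᵇ; length; lookup)
import Data.List.Properties as ListP
open import Data.List.Membership.Propositional using (_∈_)
open import Data.List.Membership.Propositional.Properties
  using (∈-lookup; ∈-concat⁻′; ∈-tabulate⁻; ∈-map⁻; ∈-filter⁻)
import Data.List.Relation.Unary.All as All
import Data.List.Relation.Unary.All.Properties as AllP
open import Data.List.Relation.Unary.AllPairs as AllPairs using (AllPairs; []; _∷_)
import Data.List.Relation.Unary.AllPairs.Properties as AllPairsP
open import Data.List.Relation.Unary.Unique.Propositional using (Unique)
import Data.List.Relation.Unary.Unique.Propositional.Properties as UniqueP
open import Function using (_∘_; id)
open import Function.Bundles using (Equivalence)
open import Relation.Nullary using (¬_; Dec; contradiction; yes; no; does)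
open import Relation.Nullary.Decidable using (dec-true; dec-false; T?)
open import Relation.Binary.PropositionalEquality
  using (refl; sym; trans; cong; cong₂; subst; _≢_; module ≡-Reasoning)
open import Algebra.Properties.Semiring.Sum ℤP.+-*-semiring
  using (sum; sum-syntax; sum-cong-≗; sum-replicate-zero; sum-remove; ∑-distrib-+; ∑-comm;
         *-distribˡ-sum; *-distribʳ-sum)

-- Finite sums, indicators and lists

sumℤ-tabulate : ∀ {n} (f : Fin n → ℤ) → sumℤ (tabulate f) ≡ sum f
sumℤ-tabulate {zero}  f = refl
sumℤ-tabulate {suc n} f = cong (_+_ (f zero)) (sumℤ-tabulate (f ∘ suc))

sumℤ-allFin : ∀ {n} (f : Fin n → ℤ) → sumℤ (map f (allFin n)) ≡ sum f
sumℤ-allFin f = trans (cong sumℤ (ListP.map-tabulate id f)) (sumℤ-tabulate f)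

∑-zero : ∀ {n} {f : Fin n → ℤ} → (∀ i → f i ≡ + 0) → sum f ≡ + 0
∑-zero {n} f≡0 = trans (sum-cong-≗ f≡0) (sum-replicate-zero n)

∑-single : ∀ {n} (p : Fin (suc n)) (f : Fin (suc n) → ℤ) →
           (∀ l → f (punchIn p l) ≡ + 0) → sum f ≡ f p
∑-single p f off-p≡0 = begin
  sum f                      ≡⟨ sum-remove f ⟩
  f p + sum (f ∘ punchIn p)  ≡⟨ cong (_+_ (f p)) (∑-zero off-p≡0) ⟩
  f p + + 0                  ≡⟨ ℤP.+-identityʳ (f p) ⟩
  f p                        ∎
  where open ≡-Reasoning

∑-punchIn : ∀ {n} (p : Fin (suc n)) (f : Fin (suc n) → ℤ) →
            ∑[ l < n ] f (punchIn p l) ≡ sum f - f p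
∑-punchIn p f = begin
  sum (f ∘ punchIn p)                ≡⟨ add-sub (f p) (sum (f ∘ punchIn p)) ⟩
  (f p + sum (f ∘ punchIn p)) - f p  ≡⟨ cong (_- f p) (sum-remove f) ⟨
  sum f - f p                        ∎
  where
  open ≡-Reasoning
  add-sub : ∀ a b → b ≡ (a + b) - a
  add-sub = solve-∀

∑-↑ : ∀ m {n} (f : Fin (m ℕ.+ n) → ℤ) →
      sum f ≡ ∑[ i < m ] f (i ↑ˡ n) + ∑[ j < n ] f (m ↑ʳ j)
∑-↑ zero    f = sym (ℤP.+-identityˡ (sum f))
∑-↑ (suc m) f = trans (cong (_+_ (f zero)) (∑-↑ m (f ∘ suc))) (sym (ℤP.+-assoc (f zero) _ _))

∑-linear : ∀ {n} (a b : ℤ) (f g : Fin n → ℤ) →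
           ∑[ i < n ] (a * f i + b * g i) ≡ a * sum f + b * sum g
∑-linear a b f g = trans (∑-distrib-+ (λ i → a * f i) (λ i → b * g i))
  (sym (cong₂ _+_ (*-distribˡ-sum a f) (*-distribˡ-sum b g)))

∑-neg : ∀ {n} (f : Fin n → ℤ) → ∑[ i < n ] (- f i) ≡ - sum f
∑-neg f = trans (sum-cong-≗ (λ i → sym (ℤP.-1*i≡-i (f i))))
                (trans (sym (*-distribˡ-sum (- + 1) f)) (ℤP.-1*i≡-i (sum f)))

∑-swap-distinct : ∀ {n} (g : Fin (suc n) → Fin (suc n) → ℤ) →
                  ∑[ j < suc n ] ∑[ l < n ] g (punchIn j l) j ≡ ∑[ j < suc n ] ∑[ l < n ] g j (punchIn j l)
∑-swap-distinct {n} g = begin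
  ∑[ j < suc n ] ∑[ l < n ] g (punchIn j l) j
    ≡⟨ sum-cong-≗ (λ j → ∑-punchIn j (λ i → g i j)) ⟩
  ∑[ j < suc n ] (∑[ i < suc n ] g i j - g j j)
    ≡⟨ ∑-distrib-+ (λ j → ∑[ i < suc n ] g i j) (λ j → - g j j) ⟩
  ∑[ j < suc n ] ∑[ i < suc n ] g i j + diag
    ≡⟨ cong (_+ diag) (∑-comm (λ j i → g i j)) ⟩
  ∑[ i < suc n ] ∑[ j < suc n ] g i j + diag
    ≡⟨ ∑-distrib-+ (λ i → ∑[ j < suc n ] g i j) (λ i → - g i i) ⟨
  ∑[ i < suc n ] (∑[ j < suc n ] g i j - g i i)
    ≡⟨ sum-cong-≗ (λ i → ∑-punchIn i (g i)) ⟨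
  ∑[ i < suc n ] ∑[ l < n ] g i (punchIn i l) ∎
  where
  open ≡-Reasoning
  diag : ℤ
  diag = ∑[ i < suc n ] (- g i i)

∏ : ∀ {n} → (Fin n → ℤ) → ℤ
∏ {zero}  f = + 1
∏ {suc n} f = f zero * ∏ (f ∘ suc)

∏-cong : ∀ {n} {f g : Fin n → ℤ} → (∀ i → f i ≡ g i) → ∏ f ≡ ∏ g
∏-cong {zero}  _   = refl
∏-cong {suc n} f≡g = cong₂ _*_ (f≡g zero) (∏-cong (f≡g ∘ suc))

∏-ones : ∀ n → ∏ {n} (λ _ → + 1) ≡ + 1
∏-ones zero    = refl
∏-ones (suc n) = trans (ℤP.*-identityˡ _) (∏-ones n)

==ᶠ-refl : ∀ {k} (i : Fin k) → (i ==ᶠ i) ≡ true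
==ᶠ-refl i = Equivalence.to T-≡ (ℕP.≡⇒≡ᵇ (toℕ i) (toℕ i) refl)

==ᶠ-sound : ∀ {k} (i j : Fin k) → (i ==ᶠ j) ≡ true → i ≡ j
==ᶠ-sound i j i==j = FinP.toℕ-injective (ℕP.≡ᵇ⇒≡ (toℕ i) (toℕ j) (Equivalence.from T-≡ i==j))

==ᶠ-≢ : ∀ {k} {i j : Fin k} → i ≢ j → (i ==ᶠ j) ≡ false
==ᶠ-≢ {i = i} {j} i≢j with i ==ᶠ j in i==j
... | true  = contradiction (==ᶠ-sound i j i==j) i≢j
... | false = refl

<ᵇ-true : ∀ {m n} → m ℕ.< n → (m ℕ.<ᵇ n) ≡ true
<ᵇ-true m<n = Equivalence.to T-≡ (ℕP.<⇒<ᵇ m<n)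

<ᵇ-false : ∀ {m n} → n ℕ.≤ m → (m ℕ.<ᵇ n) ≡ false
<ᵇ-false {m} {n} n≤m with m ℕ.<ᵇ n in m<ᵇn
... | true  = contradiction (ℕP.<ᵇ⇒< m n (Equivalence.from T-≡ m<ᵇn)) (ℕP.≤⇒≯ n≤m)
... | false = refl

<ᵇ-sound : ∀ {m n} → (m ℕ.<ᵇ n) ≡ true → m ℕ.< n
<ᵇ-sound {m} {n} m<ᵇn = ℕP.<ᵇ⇒< m n (Equivalence.from T-≡ m<ᵇn)

∧-trueˡ : ∀ {a b} → a ∧ b ≡ true → a ≡ true
∧-trueˡ {true} _ = refl

∧-trueʳ : ∀ {a b} → a ∧ b ≡ true → b ≡ true
∧-trueʳ {true} b≡true = b≡true

∨-true : ∀ {a b} → a ∨ b ≡ true → a ≡ true ⊎ b ≡ true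
∨-true {true}  _ = inj₁ refl
∨-true {false} b≡true = inj₂ b≡true

<⇒≢ : ∀ {k} {i j : Fin k} → toℕ i ℕ.< toℕ j → i ≢ j
<⇒≢ i<j refl = ℕP.<-irrefl refl i<j

𝟙 : Bool → ℤ
𝟙 true  = + 1
𝟙 false = + 0

𝟙-∧ : ∀ a b → 𝟙 (a ∧ b) ≡ 𝟙 a * 𝟙 b
𝟙-∧ true  b = sym (ℤP.*-identityˡ (𝟙 b))
𝟙-∧ false b = refl

δ : ∀ {k} → Fin k → Fin k → ℤ
δ u v = 𝟙 (u ==ᶠ v)

δ-refl : ∀ {k} (u : Fin k) → δ u u ≡ + 1
δ-refl u = cong 𝟙 (==ᶠ-refl u)

δ-≢ : ∀ {k} {u v : Fin k} → u ≢ v → δ u v ≡ + 0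
δ-≢ u≢v = cong 𝟙 (==ᶠ-≢ u≢v)

δ-vanish : ∀ {k} {u v : Fin k} {x} → (u ≡ v → x ≡ + 0) → δ u v * x ≡ + 0
δ-vanish {u = u} {v} {x} x≡0 with u ≟ v
... | yes refl = trans (cong (δ u u *_) (x≡0 refl)) (ℤP.*-zeroʳ (δ u u))
... | no u≢v   = cong (_* x) (δ-≢ u≢v)

∑-δ : ∀ {k} (z : Fin k) (f : Fin k → ℤ) → ∑[ v < k ] (δ z v * f v) ≡ f z
∑-δ {suc k} z f =
  trans (∑-single z (λ v → δ z v * f v) off-z) (trans (cong (_* f z) (δ-refl z)) (ℤP.*-identityˡ (f z)))
  where
  off-z : ∀ l → δ z (punchIn z l) * f (punchIn z l) ≡ + 0
  off-z l = cong (_* f (punchIn z l)) (δ-≢ (FinP.punchInᵢ≢i z l ∘ sym))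

∑-collapse : ∀ {k} (I : Fin k → ℤ) (a b c : ℤ) (z z′ : Fin k) →
  ∑[ r < k ] (I r * (a + b * δ z r + c * δ z′ r)) ≡ a * sum I + b * I z + c * I z′
∑-collapse {k} I a b c z z′ = begin
  ∑[ r < k ] (I r * (a + b * δ z r + c * δ z′ r))
    ≡⟨ sum-cong-≗ (λ r → spread (I r) a b c (δ z r) (δ z′ r)) ⟩
  ∑[ r < k ] (a * I r + b * (δ z r * I r) + c * (δ z′ r * I r))
    ≡⟨ ∑-distrib-+ (λ r → a * I r + b * (δ z r * I r)) (λ r → c * (δ z′ r * I r)) ⟩
  ∑[ r < k ] (a * I r + b * (δ z r * I r)) + ∑[ r < k ] (c * (δ z′ r * I r))
    ≡⟨ cong₂ _+_ (∑-linear a b I (λ r → δ z r * I r)) (sym (*-distribˡ-sum c (λ r → δ z′ r * I r))) ⟩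
  a * sum I + b * ∑[ r < k ] (δ z r * I r) + c * ∑[ r < k ] (δ z′ r * I r)
    ≡⟨ cong₂ (λ x y → a * sum I + b * x + c * y) (∑-δ z I) (∑-δ z′ I) ⟩
  a * sum I + b * I z + c * I z′ ∎
  where
  open ≡-Reasoning
  spread : ∀ i a b c d d′ → i * (a + b * d + c * d′) ≡ a * i + b * (d * i) + c * (d′ * i)
  spread = solve-∀

∑-prefix : ∀ {n} h → h ℕ.≤ n → ∑[ j < n ] 𝟙 (toℕ j ℕ.<ᵇ h) ≡ + h
∑-prefix {zero}  zero    _   = refl
∑-prefix {suc n} zero    _   = ∑-zero {suc n} (λ _ → refl)
∑-prefix {suc n} (suc h) h≤n = cong (_+_ (+ 1)) (∑-prefix h (ℕ.s≤s⁻¹ h≤n))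

∑-interval : ∀ {n} lo hi (f : Fin n → ℤ) → lo ℕ.≤ hi → hi ℕ.≤ n →
  (∀ j → toℕ j ℕ.< lo → f j ≡ + 0) → (∀ j → lo ℕ.≤ toℕ j → toℕ j ℕ.< hi → f j ≡ + 1) →
  (∀ j → hi ℕ.≤ toℕ j → f j ≡ + 0) → sum f + + lo ≡ + hi
∑-interval {n} lo hi f lo≤hi hi≤n below inside above = begin
  sum f + + lo
    ≡⟨ cong (_+ + lo) (sum-cong-≗ indicator) ⟩
  ∑[ j < n ] (𝟙 (toℕ j ℕ.<ᵇ hi) - 𝟙 (toℕ j ℕ.<ᵇ lo)) + + lo
    ≡⟨ cong (_+ + lo) (∑-distrib-+ {n} (λ j → 𝟙 (toℕ j ℕ.<ᵇ hi)) (λ j → - 𝟙 (toℕ j ℕ.<ᵇ lo))) ⟩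
  ∑[ j < n ] 𝟙 (toℕ j ℕ.<ᵇ hi) + ∑[ j < n ] (- 𝟙 (toℕ j ℕ.<ᵇ lo)) + + lo
    ≡⟨ cong (_+ + lo) (cong₂ _+_ (∑-prefix hi hi≤n)
         (trans (∑-neg {n} (λ j → 𝟙 (toℕ j ℕ.<ᵇ lo))) (cong -_ (∑-prefix lo (ℕP.≤-trans lo≤hi hi≤n))))) ⟩
  + hi + - + lo + + lo
    ≡⟨ cancel (+ hi) (+ lo) ⟩
  + hi ∎
  where
  open ≡-Reasoning
  cancel : ∀ h l → h + - l + l ≡ h
  cancel = solve-∀
  indicator : ∀ j → f j ≡ 𝟙 (toℕ j ℕ.<ᵇ hi) - 𝟙 (toℕ j ℕ.<ᵇ lo)
  indicator j with toℕ j ℕ.<? lo | toℕ j ℕ.<? hi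
  ... | yes j<lo | _ = trans (below j j<lo)
          (sym (cong₂ (λ a b → 𝟙 a - 𝟙 b) (<ᵇ-true (ℕP.<-≤-trans j<lo lo≤hi)) (<ᵇ-true j<lo)))
  ... | no j≮lo | yes j<hi = trans (inside j (ℕP.≮⇒≥ j≮lo) j<hi)
          (sym (cong₂ (λ a b → 𝟙 a - 𝟙 b) (<ᵇ-true j<hi) (<ᵇ-false (ℕP.≮⇒≥ j≮lo))))
  ... | no j≮lo | no j≮hi = trans (above j (ℕP.≮⇒≥ j≮hi))
          (sym (cong₂ (λ a b → 𝟙 a - 𝟙 b) (<ᵇ-false (ℕP.≮⇒≥ j≮hi)) (<ᵇ-false (ℕP.≮⇒≥ j≮lo))))

sumℤ-++ : ∀ xs ys → sumℤ (xs ++ ys) ≡ sumℤ xs + sumℤ ys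
sumℤ-++ []       ys = sym (ℤP.+-identityˡ (sumℤ ys))
sumℤ-++ (x ∷ xs) ys = trans (cong (_+_ x) (sumℤ-++ xs ys)) (sym (ℤP.+-assoc x (sumℤ xs) (sumℤ ys)))

sumℤ-concatMap : ∀ {A B : Set} (f : B → ℤ) (g : A → List B) xs →
  sumℤ (map f (concatMap g xs)) ≡ sumℤ (map (λ x → sumℤ (map f (g x))) xs)
sumℤ-concatMap f g []       = refl
sumℤ-concatMap f g (x ∷ xs) = begin
  sumℤ (map f (g x ++ concatMap g xs))
    ≡⟨ cong sumℤ (ListP.map-++ f (g x) (concatMap g xs)) ⟩
  sumℤ (map f (g x) ++ map f (concatMap g xs))
    ≡⟨ sumℤ-++ (map f (g x)) (map f (concatMap g xs)) ⟩
  sumℤ (map f (g x)) + sumℤ (map f (concatMap g xs))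
    ≡⟨ cong (_+_ (sumℤ (map f (g x)))) (sumℤ-concatMap f g xs) ⟩
  sumℤ (map f (g x)) + sumℤ (map (λ x → sumℤ (map f (g x))) xs) ∎
  where open ≡-Reasoning

sumℤ-filterᵇ : ∀ {A : Set} (f : A → ℤ) (p : A → Bool) xs →
  sumℤ (map f (filterᵇ p xs)) ≡ sumℤ (map (λ x → 𝟙 (p x) * f x) xs)
sumℤ-filterᵇ f p []       = refl
sumℤ-filterᵇ f p (x ∷ xs) with p x
... | true  = cong₂ _+_ (sym (ℤP.*-identityˡ (f x))) (sumℤ-filterᵇ f p xs)
... | false = trans (sumℤ-filterᵇ f p xs) (sym (ℤP.+-identityˡ _))

sumℤ-filter-allFin : ∀ {k} (f : Fin k → ℤ) (p : Fin k → Bool) →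
  sumℤ (map f (filterᵇ p (allFin k))) ≡ ∑[ i < k ] (𝟙 (p i) * f i)
sumℤ-filter-allFin f p = trans (sumℤ-filterᵇ f p (allFin _)) (sumℤ-allFin (λ i → 𝟙 (p i) * f i))

length-as-sumℤ : ∀ {A : Set} (xs : List A) → + length xs ≡ sumℤ (map (λ _ → + 1) xs)
length-as-sumℤ []       = refl
length-as-sumℤ (_ ∷ xs) = cong (_+_ (+ 1)) (length-as-sumℤ xs)

length-filter-filter : ∀ {n} (p q : Fin n → Bool) →
  + length (filterᵇ q (filterᵇ p (allFin n))) ≡ ∑[ j < n ] (𝟙 (p j) * 𝟙 (q j))
length-filter-filter p q = begin
  + length (filterᵇ q (filterᵇ p (allFin _)))
    ≡⟨ length-as-sumℤ (filterᵇ q (filterᵇ p (allFin _))) ⟩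
  sumℤ (map (λ _ → + 1) (filterᵇ q (filterᵇ p (allFin _))))
    ≡⟨ sumℤ-filterᵇ (λ _ → + 1) q (filterᵇ p (allFin _)) ⟩
  sumℤ (map (λ j → 𝟙 (q j) * + 1) (filterᵇ p (allFin _)))
    ≡⟨ sumℤ-filter-allFin (λ j → 𝟙 (q j) * + 1) p ⟩
  ∑[ j < _ ] (𝟙 (p j) * (𝟙 (q j) * + 1))
    ≡⟨ sum-cong-≗ (λ j → cong (𝟙 (p j) *_) (ℤP.*-identityʳ (𝟙 (q j)))) ⟩
  ∑[ j < _ ] (𝟙 (p j) * 𝟙 (q j)) ∎
  where open ≡-Reasoning

∈-filterᵇ⁻ : ∀ {A : Set} (p : A → Bool) {xs y} → y ∈ filterᵇ p xs → y ∈ xs × p y ≡ true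
∈-filterᵇ⁻ p {xs} y∈ with ∈-filter⁻ (T? ∘ p) {xs = xs} y∈
... | y∈xs , py = y∈xs , Equivalence.to T-≡ py

filterᵇ-none : ∀ {A : Set} (p : A → Bool) {xs} → All.All (λ y → p y ≡ false) xs → filterᵇ p xs ≡ []
filterᵇ-none p All.[] = refl
filterᵇ-none p (py All.∷ pys) rewrite py = filterᵇ-none p pys

filterᵇ-all : ∀ {A : Set} (p : A → Bool) {xs} → All.All (λ y → p y ≡ true) xs → filterᵇ p xs ≡ xs
filterᵇ-all p All.[] = refl
filterᵇ-all p {x ∷ _} (py All.∷ pys) rewrite py = cong (x ∷_) (filterᵇ-all p pys)

filterᵇ-partition : ∀ {A : Set} (P : A → Bool) {xs} → AllPairs (λ a b → P b ≡ true → P a ≡ true) xs →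
                    filterᵇ P xs ++ filterᵇ (not ∘ P) xs ≡ xs
filterᵇ-partition P {[]} [] = refl
filterᵇ-partition P {x ∷ xs} (down ∷ sorted) with P x
... | true  = cong (x ∷_) (filterᵇ-partition P sorted)
... | false = trans (cong (_++ (x ∷ filterᵇ (not ∘ P) xs)) (filterᵇ-none P (All.map (falsify _) down)))
                    (cong (x ∷_) (filterᵇ-all (not ∘ P) (All.map (cong not ∘ falsify _) down)))
  where
  falsify : ∀ b → (b ≡ true → false ≡ true) → b ≡ false
  falsify true  absurd = contradiction (absurd refl) (λ ())
  falsify false _      = refl

allFin-sorted : ∀ n → AllPairs (λ a b → toℕ a ℕ.< toℕ b) (allFin n)
allFin-sorted n = AllPairsP.tabulate⁺-< id

lookup-injective : ∀ {A : Set} {xs : List A} → Unique xs → ∀ {i j} → lookup xs i ≡ lookup xs j → i ≡ j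
lookup-injective (_   ∷ _)     {zero}  {zero}  _  = refl
lookup-injective (x≢ ∷ _)     {zero}  {suc j} eq = contradiction eq (All.lookup x≢ (∈-lookup j))
lookup-injective (x≢ ∷ _)     {suc i} {zero}  eq = contradiction (sym eq) (All.lookup x≢ (∈-lookup i))
lookup-injective (_   ∷ uniq) {suc i} {suc j} eq = cong suc (lookup-injective uniq eq)

lookup-++-↑ˡ : ∀ {A : Set} (xs ys : List A) i →
               lookup (xs ++ ys) (cast (sym (ListP.length-++ xs)) (i ↑ˡ length ys)) ≡ lookup xs i
lookup-++-↑ˡ (x ∷ xs) ys zero    = refl
lookup-++-↑ˡ (x ∷ xs) ys (suc i) = lookup-++-↑ˡ xs ys i

lookup-++-↑ʳ : ∀ {A : Set} (xs ys : List A) j →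
               lookup (xs ++ ys) (cast (sym (ListP.length-++ xs)) (length xs ↑ʳ j)) ≡ lookup ys j
lookup-++-↑ʳ []       ys j = cong (lookup ys) (FinP.cast-is-id _ j)
lookup-++-↑ʳ (x ∷ xs) ys j = lookup-++-↑ʳ xs ys j

unique-concat-tabulate : ∀ {A : Set} {n} (F : Fin n → List A) (key : A → ℕ) →
  (∀ i → Unique (F i)) → (∀ i {a} → a ∈ F i → key a ≡ toℕ i) → Unique (concat (tabulate F))
unique-concat-tabulate {n = zero}  F key unique keyed = []
unique-concat-tabulate {n = suc n} F key unique keyed =
  UniqueP.++⁺ (unique zero) (unique-concat-tabulate (F ∘ suc) (ℕ.pred ∘ key) (unique ∘ suc) keyed′) disjoint
  where
  keyed′ : ∀ i {a} → a ∈ F (suc i) → ℕ.pred (key a) ≡ toℕ i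
  keyed′ i a∈ = cong ℕ.pred (keyed (suc i) a∈)
  disjoint : ∀ {a} → ¬ (a ∈ F zero × a ∈ concat (tabulate (F ∘ suc)))
  disjoint (a∈first , a∈rest) with ∈-concat⁻′ (tabulate (F ∘ suc)) a∈rest
  ... | xs , a∈xs , xs∈ with ∈-tabulate⁻ xs∈
  ...   | j , refl = contradiction (trans (sym (keyed zero a∈first)) (keyed (suc j) a∈xs)) (λ ())

-- Determinants

sgn : ℕ → ℤ
sgn k = (- + 1) ^ k

minor : ∀ {k} → Fin (suc k) → Matrix (suc k) → Matrix k
minor j M r c = M (suc r) (punchIn j c)

det-expand : ∀ {k} (M : Matrix (suc k)) →
             det (suc k) M ≡ ∑[ j < suc k ] (sgn (toℕ j) * M zero j * det k (minor j M))
det-expand {k} M = sumℤ-allFin (λ j → sgn (toℕ j) * M zero j * det k (minor j M))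

det-cong : ∀ {k} {M N : Matrix k} → (∀ r c → M r c ≡ N r c) → det k M ≡ det k N
det-cong {zero}  M≡N = refl
det-cong {suc k} {M} {N} M≡N = cong sumℤ (ListP.map-cong term≡ (allFin (suc k)))
  where
  term≡ : ∀ j → sgn (toℕ j) * M zero j * det k (minor j M) ≡ sgn (toℕ j) * N zero j * det k (minor j N)
  term≡ j = cong₂ (λ a d → sgn (toℕ j) * a * d) (M≡N zero j)
                  (det-cong (λ r c → M≡N (suc r) (punchIn j c)))

det-linear₀ : ∀ {k} (a b : ℤ) (u v : Fin (suc k) → ℤ) (R : Fin k → Fin (suc k) → ℤ) →
  det (suc k) ((λ c → a * u c + b * v c) ◂ R) ≡ a * det (suc k) (u ◂ R) + b * det (suc k) (v ◂ R)
det-linear₀ {k} a b u v R = begin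
  det (suc k) ((λ c → a * u c + b * v c) ◂ R)
    ≡⟨ det-expand ((λ c → a * u c + b * v c) ◂ R) ⟩
  ∑[ j < suc k ] (sgn (toℕ j) * (a * u j + b * v j) * D j)
    ≡⟨ sum-cong-≗ (λ j → distribute a b (sgn (toℕ j)) (u j) (v j) (D j)) ⟩
  ∑[ j < suc k ] (a * (sgn (toℕ j) * u j * D j) + b * (sgn (toℕ j) * v j * D j))
    ≡⟨ ∑-linear a b (λ j → sgn (toℕ j) * u j * D j) (λ j → sgn (toℕ j) * v j * D j) ⟩
  a * ∑[ j < suc k ] (sgn (toℕ j) * u j * D j) + b * ∑[ j < suc k ] (sgn (toℕ j) * v j * D j)
    ≡⟨ cong₂ (λ x y → a * x + b * y) (det-expand (u ◂ R)) (det-expand (v ◂ R)) ⟨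
  a * det (suc k) (u ◂ R) + b * det (suc k) (v ◂ R) ∎
  where
  open ≡-Reasoning
  D : Fin (suc k) → ℤ
  D j = det k (λ r c → R r (punchIn j c))
  distribute : ∀ a b s x y d → s * (a * x + b * y) * d ≡ a * (s * x * d) + b * (s * y * d)
  distribute = solve-∀

det-linear₁ : ∀ {k} (a b : ℤ) (w u v : Fin (suc (suc k)) → ℤ) (R : Fin k → Fin (suc (suc k)) → ℤ) →
  det (suc (suc k)) (w ◂ (λ c → a * u c + b * v c) ◂ R)
    ≡ a * det (suc (suc k)) (w ◂ u ◂ R) + b * det (suc (suc k)) (w ◂ v ◂ R)
det-linear₁ {k} a b w u v R = begin
  det (suc (suc k)) (w ◂ lin ◂ R)
    ≡⟨ det-expand (w ◂ lin ◂ R) ⟩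
  ∑[ j < suc (suc k) ] (sgn (toℕ j) * w j * det (suc k) (minor j (w ◂ lin ◂ R)))
    ≡⟨ sum-cong-≗ term ⟩
  ∑[ j < suc (suc k) ] (a * (sgn (toℕ j) * w j * D u j) + b * (sgn (toℕ j) * w j * D v j))
    ≡⟨ ∑-linear a b (λ j → sgn (toℕ j) * w j * D u j) (λ j → sgn (toℕ j) * w j * D v j) ⟩
  a * ∑[ j < suc (suc k) ] (sgn (toℕ j) * w j * D u j) + b * ∑[ j < suc (suc k) ] (sgn (toℕ j) * w j * D v j)
    ≡⟨ cong₂ (λ x y → a * x + b * y) (det-expand (w ◂ u ◂ R)) (det-expand (w ◂ v ◂ R)) ⟨
  a * det (suc (suc k)) (w ◂ u ◂ R) + b * det (suc (suc k)) (w ◂ v ◂ R) ∎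
  where
  open ≡-Reasoning
  lin : Fin (suc (suc k)) → ℤ
  lin c = a * u c + b * v c
  D : (Fin (suc (suc k)) → ℤ) → Fin (suc (suc k)) → ℤ
  D x j = det (suc k) (minor j (w ◂ x ◂ R))
  minor-rows : ∀ x j → D x j ≡ det (suc k) ((x ∘ punchIn j) ◂ (λ r c → R r (punchIn j c)))
  minor-rows x j = det-cong {M = minor j (w ◂ x ◂ R)} {N = (x ∘ punchIn j) ◂ (λ r c → R r (punchIn j c))}
    λ { zero c → refl ; (suc r) c → refl }
  distribute : ∀ a b s x y z → s * x * (a * y + b * z) ≡ a * (s * x * y) + b * (s * x * z)
  distribute = solve-∀
  term : ∀ j → sgn (toℕ j) * w j * D lin j ≡ a * (sgn (toℕ j) * w j * D u j) + b * (sgn (toℕ j) * w j * D v j)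
  term j = begin
    sgn (toℕ j) * w j * D lin j
      ≡⟨ cong (sgn (toℕ j) * w j *_) (trans (minor-rows lin j)
           (det-linear₀ a b (u ∘ punchIn j) (v ∘ punchIn j) (λ r c → R r (punchIn j c)))) ⟩
    sgn (toℕ j) * w j * (a * D′ u + b * D′ v)
      ≡⟨ distribute a b (sgn (toℕ j)) (w j) (D′ u) (D′ v) ⟩
    a * (sgn (toℕ j) * w j * D′ u) + b * (sgn (toℕ j) * w j * D′ v)
      ≡⟨ cong₂ (λ x y → a * (sgn (toℕ j) * w j * x) + b * (sgn (toℕ j) * w j * y))
               (minor-rows u j) (minor-rows v j) ⟨
    a * (sgn (toℕ j) * w j * D u j) + b * (sgn (toℕ j) * w j * D v j) ∎
    where
    D′ : (Fin (suc (suc k)) → ℤ) → ℤ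
    D′ x = det (suc k) ((x ∘ punchIn j) ◂ (λ r c → R r (punchIn j c)))

det-expand₂ : ∀ {k} (u v : Fin (suc (suc k)) → ℤ) (R : Fin k → Fin (suc (suc k)) → ℤ) →
  det (suc (suc k)) (u ◂ v ◂ R)
    ≡ ∑[ j < suc (suc k) ] ∑[ l < suc k ]
        (sgn (toℕ j) * sgn (toℕ l) * u j * v (punchIn j l) * det k (λ r c → R r (punchIn j (punchIn l c))))
det-expand₂ {k} u v R = trans (det-expand (u ◂ v ◂ R)) (sum-cong-≗ λ j → begin
  sgn (toℕ j) * u j * det (suc k) (minor j (u ◂ v ◂ R))
    ≡⟨ cong (sgn (toℕ j) * u j *_) (det-expand (minor j (u ◂ v ◂ R))) ⟩
  sgn (toℕ j) * u j * ∑[ l < suc k ] (sgn (toℕ l) * v (punchIn j l) * D j l)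
    ≡⟨ *-distribˡ-sum (sgn (toℕ j) * u j) (λ l → sgn (toℕ l) * v (punchIn j l) * D j l) ⟩
  ∑[ l < suc k ] (sgn (toℕ j) * u j * (sgn (toℕ l) * v (punchIn j l) * D j l))
    ≡⟨ sum-cong-≗ (λ l → reassoc (sgn (toℕ j)) (u j) (sgn (toℕ l)) (v (punchIn j l)) (D j l)) ⟩
  ∑[ l < suc k ] (sgn (toℕ j) * sgn (toℕ l) * u j * v (punchIn j l) * D j l) ∎)
  where
  open ≡-Reasoning
  D : Fin (suc (suc k)) → Fin (suc k) → ℤ
  D j l = det k (λ r c → R r (punchIn j (punchIn l c)))
  reassoc : ∀ s x s′ y d → s * x * (s′ * y * d) ≡ s * s′ * x * y * d
  reassoc = solve-∀

-- punchOut without its proof of a ≢ b; the value at a ≡ b is never used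
skip : ∀ {k} → Fin (suc (suc k)) → Fin (suc (suc k)) → Fin (suc k)
skip zero    zero    = zero
skip zero    (suc b) = b
skip (suc a) zero    = zero
skip {zero}  (suc a) (suc b) = zero
skip {suc k} (suc a) (suc b) = suc (skip a b)

skip-punchIn : ∀ {k} (a : Fin (suc (suc k))) (l : Fin (suc k)) → skip a (punchIn a l) ≡ l
skip-punchIn zero    l       = refl
skip-punchIn (suc a) zero    = refl
skip-punchIn {suc k} (suc a) (suc l) = cong suc (skip-punchIn a l)

punchIn-skip : ∀ {k} {a b : Fin (suc (suc k))} → a ≢ b → ∀ c →
               punchIn a (punchIn (skip a b) c) ≡ punchIn b (punchIn (skip b a) c)
punchIn-skip {a = zero}  {zero}  a≢b c = contradiction refl a≢b
punchIn-skip {a = zero}  {suc b} a≢b c = refl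
punchIn-skip {a = suc a} {zero}  a≢b c = refl
punchIn-skip {zero}  {suc zero} {suc zero} a≢b c = contradiction refl a≢b
punchIn-skip {suc k} {suc a} {suc b} a≢b zero    = refl
punchIn-skip {suc k} {suc a} {suc b} a≢b (suc c) = cong suc (punchIn-skip (a≢b ∘ cong suc) c)

sgn-suc : ∀ k → sgn (suc k) ≡ - sgn k
sgn-suc k = ℤP.-1*i≡-i (sgn k)

sgn-skip : ∀ {k} {a b : Fin (suc (suc k))} → a ≢ b →
           sgn (toℕ a) * sgn (toℕ (skip a b)) ≡ - (sgn (toℕ b) * sgn (toℕ (skip b a)))
sgn-skip {a = zero}  {zero}  a≢b = contradiction refl a≢b
sgn-skip {a = zero}  {suc b} a≢b = begin
  + 1 * sgn (toℕ b)            ≡⟨ ℤP.*-identityˡ _ ⟩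
  sgn (toℕ b)                  ≡⟨ ℤP.neg-involutive _ ⟨
  - - sgn (toℕ b)              ≡⟨ cong -_ (trans (ℤP.*-identityʳ _) (sgn-suc (toℕ b))) ⟨
  - (sgn (suc (toℕ b)) * + 1)  ∎
  where open ≡-Reasoning
sgn-skip {a = suc a} {zero}  a≢b =
  trans (ℤP.*-identityʳ _) (trans (sgn-suc (toℕ a)) (cong -_ (sym (ℤP.*-identityˡ _))))
sgn-skip {zero}  {suc zero} {suc zero} a≢b = contradiction refl a≢b
sgn-skip {suc k} {suc a} {suc b} a≢b = begin
  sgn (suc (toℕ a)) * sgn (suc (toℕ (skip a b)))
    ≡⟨ cong₂ _*_ (sgn-suc (toℕ a)) (sgn-suc (toℕ (skip a b))) ⟩
  - sgn (toℕ a) * - sgn (toℕ (skip a b))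
    ≡⟨ neg*neg (sgn (toℕ a)) (sgn (toℕ (skip a b))) ⟩
  sgn (toℕ a) * sgn (toℕ (skip a b))
    ≡⟨ sgn-skip (a≢b ∘ cong suc) ⟩
  - (sgn (toℕ b) * sgn (toℕ (skip b a)))
    ≡⟨ cong -_ (neg*neg (sgn (toℕ b)) (sgn (toℕ (skip b a)))) ⟨
  - (- sgn (toℕ b) * - sgn (toℕ (skip b a)))
    ≡⟨ cong -_ (cong₂ _*_ (sgn-suc (toℕ b)) (sgn-suc (toℕ (skip b a)))) ⟨
  - (sgn (suc (toℕ b)) * sgn (suc (toℕ (skip b a)))) ∎
  where
  open ≡-Reasoning
  neg*neg : ∀ x y → - x * - y ≡ x * y
  neg*neg = solve-∀

det-swap₀₁ : ∀ {k} (u v : Fin (suc (suc k)) → ℤ) (R : Fin k → Fin (suc (suc k)) → ℤ) →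
             det (suc (suc k)) (v ◂ u ◂ R) ≡ - det (suc (suc k)) (u ◂ v ◂ R)
det-swap₀₁ {k} u v R = begin
  det (suc (suc k)) (v ◂ u ◂ R)
    ≡⟨ det-expand₂ v u R ⟩
  ∑[ j < suc (suc k) ] ∑[ l < suc k ] (sgn (toℕ j) * sgn (toℕ l) * v j * u (punchIn j l) * D₂ j l)
    ≡⟨ sum-cong-≗ (λ j → trans (sum-cong-≗ (swapped j)) (∑-neg (λ l → F (punchIn j l) j))) ⟩
  ∑[ j < suc (suc k) ] (- ∑[ l < suc k ] F (punchIn j l) j)
    ≡⟨ ∑-neg (λ j → ∑[ l < suc k ] F (punchIn j l) j) ⟩
  - ∑[ j < suc (suc k) ] ∑[ l < suc k ] F (punchIn j l) j
    ≡⟨ cong -_ (∑-swap-distinct F) ⟩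
  - ∑[ j < suc (suc k) ] ∑[ l < suc k ] F j (punchIn j l)
    ≡⟨ cong -_ (sum-cong-≗ (λ j → sum-cong-≗ (expanded j))) ⟨
  - ∑[ j < suc (suc k) ] ∑[ l < suc k ] (sgn (toℕ j) * sgn (toℕ l) * u j * v (punchIn j l) * D₂ j l)
    ≡⟨ cong -_ (det-expand₂ u v R) ⟨
  - det (suc (suc k)) (u ◂ v ◂ R) ∎
  where
  open ≡-Reasoning
  D₂ : Fin (suc (suc k)) → Fin (suc k) → ℤ
  D₂ j l = det k (λ r c → R r (punchIn j (punchIn l c)))
  F : Fin (suc (suc k)) → Fin (suc (suc k)) → ℤ
  F a b = sgn (toℕ a) * sgn (toℕ (skip a b)) * u a * v b * D₂ a (skip a b)
  expanded : ∀ j l → sgn (toℕ j) * sgn (toℕ l) * u j * v (punchIn j l) * D₂ j l ≡ F j (punchIn j l)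
  expanded j l = cong (λ m → sgn (toℕ j) * sgn (toℕ m) * u j * v (punchIn j l) * D₂ j m) (sym (skip-punchIn j l))
  flip : ∀ s x y d → s * y * x * d ≡ - (- s * x * y * d)
  flip = solve-∀
  swapped : ∀ j l → sgn (toℕ j) * sgn (toℕ l) * v j * u (punchIn j l) * D₂ j l ≡ - F (punchIn j l) j
  swapped j l = begin
    sgn (toℕ j) * sgn (toℕ l) * v j * u a * D₂ j l
      ≡⟨ flip (sgn (toℕ j) * sgn (toℕ l)) (u a) (v j) (D₂ j l) ⟩
    - (- (sgn (toℕ j) * sgn (toℕ l)) * u a * v j * D₂ j l)
      ≡⟨ cong -_ (cong₂ (λ s d → s * u a * v j * d) sign≡ D≡) ⟨
    - F a j ∎
    where
    a : Fin (suc (suc k))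
    a = punchIn j l
    a≢j : a ≢ j
    a≢j = FinP.punchInᵢ≢i j l
    sign≡ : sgn (toℕ a) * sgn (toℕ (skip a j)) ≡ - (sgn (toℕ j) * sgn (toℕ l))
    sign≡ = trans (sgn-skip a≢j) (cong (λ m → - (sgn (toℕ j) * sgn (toℕ m))) (skip-punchIn j l))
    D≡ : D₂ a (skip a j) ≡ D₂ j l
    D≡ = trans (det-cong (λ r c → cong (R r) (punchIn-skip a≢j c))) (cong (D₂ j) (skip-punchIn j l))

det-equal₀₁ : ∀ {k} (u : Fin (suc (suc k)) → ℤ) (R : Fin k → Fin (suc (suc k)) → ℤ) →
              det (suc (suc k)) (u ◂ u ◂ R) ≡ + 0
det-equal₀₁ u R = self-negation (det-swap₀₁ u u R)
  where
  self-negation : ∀ {x} → x ≡ - x → x ≡ + 0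
  self-negation {+ 0}        _  = refl
  self-negation {+ suc _}  ()
  self-negation { -[1+ _ ]} ()

*-zero-middle : ∀ a b → a * + 0 * b ≡ + 0
*-zero-middle = solve-∀

det-singleEntryRow : ∀ {k} (p : Fin (suc k)) (M : Matrix (suc k)) → (∀ l → M zero (punchIn p l) ≡ + 0) →
                     det (suc k) M ≡ sgn (toℕ p) * M zero p * det k (minor p M)
det-singleEntryRow {k} p M off-p≡0 =
  trans (det-expand M) (∑-single p (λ j → sgn (toℕ j) * M zero j * det k (minor j M)) vanish)
  where
  vanish : ∀ l → sgn (toℕ (punchIn p l)) * M zero (punchIn p l) * det k (minor (punchIn p l) M) ≡ + 0
  vanish l = trans (cong (λ x → sgn (toℕ (punchIn p l)) * x * det k (minor (punchIn p l) M)) (off-p≡0 l))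
                   (*-zero-middle (sgn (toℕ (punchIn p l))) (det k (minor (punchIn p l) M)))

scalar : ∀ {k} → ℤ → Matrix k
scalar y r c = if r ==ᶠ c then y else + 0

scalar-unit : ∀ {k} y (r c : Fin k) → scalar y r c ≡ y * scalar (+ 1) r c
scalar-unit y r c with r ==ᶠ c
... | true  = sym (ℤP.*-identityʳ y)
... | false = sym (ℤP.*-zeroʳ y)

det-scalar : ∀ k y → det k (scalar y) ≡ y ^ k
det-scalar zero    y = refl
det-scalar (suc k) y = begin
  det (suc k) (scalar y)      ≡⟨ det-singleEntryRow {k} zero (scalar y) (λ _ → refl) ⟩
  + 1 * y * det k (scalar y)  ≡⟨ cong₂ _*_ (ℤP.*-identityˡ y) (det-scalar k y) ⟩
  y * y ^ k                   ∎
  where open ≡-Reasoning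

scalarMinusOnes : ∀ {k} → ℤ → Matrix k
scalarMinusOnes y r c = scalar y r c - + 1

-- Row 1 is y e₁ − 𝟙.  Its 𝟙-part repeats row 0, and its e₁-part, once swapped to the top,
-- expands to the same kind of matrix one size smaller.
det-onesRow : ∀ k y → det (suc k) ((λ _ → + 1) ◂ (λ r → scalarMinusOnes y (suc r))) ≡ y ^ k
det-onesRow zero    y = refl
det-onesRow (suc k) y = begin
  det (suc (suc k)) (ones ◂ (λ r → scalarMinusOnes y (suc r)))
    ≡⟨ det-cong {M = ones ◂ (λ r → scalarMinusOnes y (suc r))} {N = ones ◂ row₁ ◂ R}
         (λ { zero c → refl ; (suc zero) c → row₁-split c ; (suc (suc r)) c → refl }) ⟩
  det (suc (suc k)) (ones ◂ row₁ ◂ R)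
    ≡⟨ det-linear₁ y (- + 1) ones e₁ ones R ⟩
  y * det (suc (suc k)) (ones ◂ e₁ ◂ R) + - + 1 * det (suc (suc k)) (ones ◂ ones ◂ R)
    ≡⟨ cong₂ (λ a b → y * a + - + 1 * b) (det-swap₀₁ e₁ ones R) (det-equal₀₁ ones R) ⟩
  y * - det (suc (suc k)) (e₁ ◂ ones ◂ R) + - + 1 * + 0
    ≡⟨ cong (λ a → y * - a + - + 1 * + 0)
         (det-singleEntryRow (suc zero) (e₁ ◂ ones ◂ R) (λ { zero → refl ; (suc l) → refl })) ⟩
  y * - (sgn 1 * + 1 * det (suc k) (minor (suc zero) (e₁ ◂ ones ◂ R))) + - + 1 * + 0
    ≡⟨ cong (λ a → y * - (sgn 1 * + 1 * a) + - + 1 * + 0) (trans minor≡ (det-onesRow k y)) ⟩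
  y * - (sgn 1 * + 1 * y ^ k) + - + 1 * + 0
    ≡⟨ simplify y (y ^ k) ⟩
  y * y ^ k ∎
  where
  open ≡-Reasoning
  ones e₁ row₁ : Fin (suc (suc k)) → ℤ
  ones _ = + 1
  e₁ = scalar (+ 1) (suc zero)
  row₁ c = y * e₁ c + - + 1 * ones c
  R : Fin k → Fin (suc (suc k)) → ℤ
  R r = scalarMinusOnes y (suc (suc r))
  row₁-split : ∀ c → scalarMinusOnes y (suc zero) c ≡ row₁ c
  row₁-split c = cong (_- + 1) (scalar-unit y (suc zero) c)
  minor≡ : det (suc k) (minor (suc zero) (e₁ ◂ ones ◂ R))
           ≡ det (suc k) ((λ _ → + 1) ◂ (λ r → scalarMinusOnes y (suc r)))
  minor≡ = det-cong {M = minor (suc zero) (e₁ ◂ ones ◂ R)}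
                    {N = (λ _ → + 1) ◂ (λ r → scalarMinusOnes y (suc r))}
    (λ { zero c → refl ; (suc r) zero → refl ; (suc r) (suc c) → refl })
  simplify : ∀ y d → y * - (- + 1 * + 1 * d) + - + 1 * + 0 ≡ y * d
  simplify = solve-∀

det-scalarMinusOnes-step : ∀ k y → det (suc k) (scalarMinusOnes y) ≡ y * det k (scalarMinusOnes y) - y ^ k
det-scalarMinusOnes-step k y = begin
  det (suc k) A
    ≡⟨ det-cong {M = A} {N = row₀ ◂ (A ∘ suc)} (λ { zero c → row₀-split c ; (suc r) c → refl }) ⟩
  det (suc k) (row₀ ◂ (A ∘ suc))
    ≡⟨ det-linear₀ y (- + 1) e₀ ones (A ∘ suc) ⟩
  y * det (suc k) (e₀ ◂ (A ∘ suc)) + - + 1 * det (suc k) (ones ◂ (A ∘ suc))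
    ≡⟨ cong₂ (λ a b → y * a + - + 1 * b)
             (det-singleEntryRow zero (e₀ ◂ (A ∘ suc)) (λ _ → refl)) (det-onesRow k y) ⟩
  y * (+ 1 * + 1 * det k (scalarMinusOnes y)) + - + 1 * y ^ k
    ≡⟨ simplify y (det k (scalarMinusOnes y)) (y ^ k) ⟩
  y * det k (scalarMinusOnes y) - y ^ k ∎
  where
  open ≡-Reasoning
  A : Matrix (suc k)
  A = scalarMinusOnes y
  ones e₀ row₀ : Fin (suc k) → ℤ
  ones _ = + 1
  e₀ = scalar (+ 1) zero
  row₀ c = y * e₀ c + - + 1 * ones c
  row₀-split : ∀ c → A zero c ≡ row₀ c
  row₀-split c = cong (_- + 1) (scalar-unit y zero c)
  simplify : ∀ y d p → y * (+ 1 * + 1 * d) + - + 1 * p ≡ y * d - p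
  simplify = solve-∀

det-scalarMinusOnes : ∀ k y → det (suc k) (scalarMinusOnes y) ≡ (y - + suc k) * y ^ k
det-scalarMinusOnes zero    y = trans (det-scalarMinusOnes-step 0 y) (base y)
  where
  base : ∀ y → y * + 1 - + 1 ≡ (y - + 1) * + 1
  base = solve-∀
det-scalarMinusOnes (suc k) y = begin
  det (suc (suc k)) (scalarMinusOnes y)
    ≡⟨ det-scalarMinusOnes-step (suc k) y ⟩
  y * det (suc k) (scalarMinusOnes y) - y ^ suc k
    ≡⟨ cong (λ d → y * d - y ^ suc k) (det-scalarMinusOnes k y) ⟩
  y * ((y - + suc k) * y ^ k) - y * y ^ k
    ≡⟨ step y (+ suc k) (y ^ k) ⟩
  (y - (+ 1 + + suc k)) * (y * y ^ k) ∎
  where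
  open ≡-Reasoning
  step : ∀ y c p → y * ((y - c) * p) - y * p ≡ (y - (+ 1 + c)) * (y * p)
  step = solve-∀

punchIn-↑ˡ : ∀ {k} l (c : Fin (suc k)) (d : Fin k) → punchIn (c ↑ˡ l) (d ↑ˡ l) ≡ punchIn c d ↑ˡ l
punchIn-↑ˡ l zero    d       = refl
punchIn-↑ˡ l (suc c) zero    = refl
punchIn-↑ˡ l (suc c) (suc d) = cong suc (punchIn-↑ˡ l c d)

punchIn-↑ʳ : ∀ {k} l (c : Fin (suc k)) (d : Fin l) → punchIn (c ↑ˡ l) (k ↑ʳ d) ≡ suc k ↑ʳ d
punchIn-↑ʳ l zero    d = refl
punchIn-↑ʳ {suc k} l (suc c) d = cong suc (punchIn-↑ʳ l c d)

det-blockTriangular : ∀ k {l} (M : Matrix (k ℕ.+ l)) → (∀ r c → M (r ↑ˡ l) (k ↑ʳ c) ≡ + 0) →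
  det (k ℕ.+ l) M ≡ det k (λ r c → M (r ↑ˡ l) (c ↑ˡ l)) * det l (λ r c → M (k ↑ʳ r) (k ↑ʳ c))
det-blockTriangular zero    M _ = sym (ℤP.*-identityˡ _)
det-blockTriangular (suc k) {l} M upper≡0 = begin
  det (suc k ℕ.+ l) M
    ≡⟨ det-expand M ⟩
  sum term
    ≡⟨ ∑-↑ (suc k) term ⟩
  ∑[ c < suc k ] term (c ↑ˡ l) + ∑[ d < l ] term (suc k ↑ʳ d)
    ≡⟨ cong₂ _+_ (sum-cong-≗ left-term) (∑-zero right-term) ⟩
  ∑[ c < suc k ] (sgn (toℕ c) * A zero c * det k (minor c A) * det l D) + + 0
    ≡⟨ ℤP.+-identityʳ _ ⟩
  ∑[ c < suc k ] (sgn (toℕ c) * A zero c * det k (minor c A) * det l D)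
    ≡⟨ *-distribʳ-sum (det l D) (λ c → sgn (toℕ c) * A zero c * det k (minor c A)) ⟨
  ∑[ c < suc k ] (sgn (toℕ c) * A zero c * det k (minor c A)) * det l D
    ≡⟨ cong (_* det l D) (det-expand A) ⟨
  det (suc k) A * det l D ∎
  where
  open ≡-Reasoning
  A : Matrix (suc k)
  A r c = M (r ↑ˡ l) (c ↑ˡ l)
  D : Matrix l
  D r c = M (suc k ↑ʳ r) (suc k ↑ʳ c)
  term : Fin (suc k ℕ.+ l) → ℤ
  term j = sgn (toℕ j) * M zero j * det (k ℕ.+ l) (minor j M)
  right-term : ∀ d → term (suc k ↑ʳ d) ≡ + 0
  right-term d = trans (cong (λ x → sgn (toℕ (suc k ↑ʳ d)) * x * det (k ℕ.+ l) (minor (suc k ↑ʳ d) M))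
                             (upper≡0 zero d))
                       (*-zero-middle (sgn (toℕ (suc k ↑ʳ d))) (det (k ℕ.+ l) (minor (suc k ↑ʳ d) M)))
  minor-blocks : ∀ c → det (k ℕ.+ l) (minor (c ↑ˡ l) M) ≡ det k (minor c A) * det l D
  minor-blocks c = begin
    det (k ℕ.+ l) (minor (c ↑ˡ l) M)
      ≡⟨ det-blockTriangular k (minor (c ↑ˡ l) M)
           (λ r d → trans (cong (M (suc (r ↑ˡ l))) (punchIn-↑ʳ l c d)) (upper≡0 (suc r) d)) ⟩
    det k (λ r d → M (suc (r ↑ˡ l)) (punchIn (c ↑ˡ l) (d ↑ˡ l)))
      * det l (λ r d → M (suc (k ↑ʳ r)) (punchIn (c ↑ˡ l) (k ↑ʳ d)))
      ≡⟨ cong₂ _*_ (det-cong (λ r d → cong (M (suc (r ↑ˡ l))) (punchIn-↑ˡ l c d)))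
                   (det-cong (λ r d → cong (M (suc (k ↑ʳ r))) (punchIn-↑ʳ l c d))) ⟩
    det k (minor c A) * det l D ∎
  regroup : ∀ s a x y → s * a * (x * y) ≡ s * a * x * y
  regroup = solve-∀
  left-term : ∀ c → term (c ↑ˡ l) ≡ sgn (toℕ c) * A zero c * det k (minor c A) * det l D
  left-term c = begin
    sgn (toℕ (c ↑ˡ l)) * A zero c * det (k ℕ.+ l) (minor (c ↑ˡ l) M)
      ≡⟨ cong₂ (λ i x → sgn i * A zero c * x) (FinP.toℕ-↑ˡ c l) (minor-blocks c) ⟩
    sgn (toℕ c) * A zero c * (det k (minor c A) * det l D)
      ≡⟨ regroup (sgn (toℕ c)) (A zero c) (det k (minor c A)) (det l D) ⟩
    sgn (toℕ c) * A zero c * det k (minor c A) * det l D ∎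

det-reindex : ∀ {m n} (m≡n : m ≡ n) (M : Matrix n) → det n M ≡ det m (λ r c → M (cast m≡n r) (cast m≡n c))
det-reindex refl M = det-cong (λ r c → sym (cong₂ M (FinP.cast-is-id refl r) (FinP.cast-is-id refl c)))

-- Determinants of matrices indexed by a list of labels

module _ {E : Set} (ent : E → E → ℤ) where

  labelledDet : List E → ℤ
  labelledDet L = det (length L) (λ r c → ent (lookup L r) (lookup L c))

  labelledDet-++ : ∀ A B → (∀ {a b} → a ∈ A → b ∈ B → ent a b ≡ + 0) →
                   labelledDet (A ++ B) ≡ labelledDet A * labelledDet B
  labelledDet-++ A B A×B≡0 = begin
    labelledDet (A ++ B)
      ≡⟨ det-reindex (sym (ListP.length-++ A)) _ ⟩
    det (length A ℕ.+ length B) (λ r c → ent (at r) (at c))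
      ≡⟨ det-blockTriangular (length A) _ (λ r c →
           trans (cong₂ ent (lookup-++-↑ˡ A B r) (lookup-++-↑ʳ A B c)) (A×B≡0 (∈-lookup r) (∈-lookup c))) ⟩
    det (length A) (λ r c → ent (at (r ↑ˡ length B)) (at (c ↑ˡ length B)))
      * det (length B) (λ r c → ent (at (length A ↑ʳ r)) (at (length A ↑ʳ c)))
      ≡⟨ cong₂ _*_ (det-cong (λ r c → cong₂ ent (lookup-++-↑ˡ A B r) (lookup-++-↑ˡ A B c)))
                   (det-cong (λ r c → cong₂ ent (lookup-++-↑ʳ A B r) (lookup-++-↑ʳ A B c))) ⟩
    labelledDet A * labelledDet B ∎
    where
    open ≡-Reasoning
    at : Fin (length A ℕ.+ length B) → E
    at i = lookup (A ++ B) (cast (sym (ListP.length-++ A)) i)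

  labelledDet-concat : ∀ {n} (F : Fin n → List E) →
    (∀ {i j a b} → i ≢ j → a ∈ F i → b ∈ F j → ent a b ≡ + 0) →
    labelledDet (concat (tabulate F)) ≡ ∏ (labelledDet ∘ F)
  labelledDet-concat {zero}  F _ = refl
  labelledDet-concat {suc n} F blocks≡0 = trans
    (labelledDet-++ (F zero) (concat (tabulate (F ∘ suc))) first×rest≡0)
    (cong (labelledDet (F zero) *_)
          (labelledDet-concat (F ∘ suc) (λ i≢j → blocks≡0 (i≢j ∘ FinP.suc-injective))))
    where
    first×rest≡0 : ∀ {a b} → a ∈ F zero → b ∈ concat (tabulate (F ∘ suc)) → ent a b ≡ + 0
    first×rest≡0 a∈ b∈ with ∈-concat⁻′ (tabulate (F ∘ suc)) b∈
    ... | xs , b∈xs , xs∈ with ∈-tabulate⁻ xs∈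
    ...   | j , refl = blocks≡0 (λ ()) a∈ b∈xs

  labelledDet-uniform : ∀ {L} → Unique L → (φ : Bool → ℤ) →
    (∀ {a} → a ∈ L → ent a a ≡ φ true) →
    (∀ {a b} → a ∈ L → b ∈ L → a ≢ b → ent a b ≡ φ false) →
    labelledDet L ≡ det (length L) (λ r c → φ (r ==ᶠ c))
  labelledDet-uniform {L} uniq φ diagonal off-diagonal = det-cong entry
    where
    entry : ∀ r c → ent (lookup L r) (lookup L c) ≡ φ (r ==ᶠ c)
    entry r c with r ≟ c
    ... | yes refl = trans (diagonal (∈-lookup r)) (cong φ (sym (==ᶠ-refl r)))
    ... | no r≢c   = trans (off-diagonal (∈-lookup r) (∈-lookup c) (r≢c ∘ lookup-injective uniq))
                           (cong φ (sym (==ᶠ-≢ r≢c)))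

-- The Helmholtzian of a graph

bEntry-δ : ∀ {k} {p q : Fin k} → p ≢ q → ∀ v → bEntry (p , q) v ≡ δ q v - δ p v
bEntry-δ {p = p} {q} p≢q v with v ≟ p | v ≟ q
... | yes refl | _        rewrite ==ᶠ-refl v | δ-≢ (p≢q ∘ sym) = refl
... | no v≢p   | yes refl rewrite ==ᶠ-≢ v≢p | ==ᶠ-refl v | δ-≢ (v≢p ∘ sym) = refl
... | no v≢p   | no v≢q
  rewrite ==ᶠ-≢ v≢p | ==ᶠ-≢ v≢q | δ-≢ (v≢p ∘ sym) | δ-≢ (v≢q ∘ sym) = refl

cEntry-shape : ∀ b₁ b₂ b₃ b₄ →
  (b₁ ≡ true → b₃ ≡ true → ⊥) → (b₂ ≡ true → b₄ ≡ true → ⊥) →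
  (if b₁ ∧ b₂ then + 1 else (if b₃ ∧ b₄ then + 1 else (if b₁ ∧ b₄ then - + 1 else + 0)))
    ≡ 𝟙 b₁ * 𝟙 b₂ + 𝟙 b₃ * 𝟙 b₄ - 𝟙 b₁ * 𝟙 b₄
cEntry-shape true  _     true  _     ¬13 _   = ⊥-elim (¬13 refl refl)
cEntry-shape _     true  _     true  _   ¬24 = ⊥-elim (¬24 refl refl)
cEntry-shape true  true  false false _   _   = refl
cEntry-shape true  false false true  _   _   = refl
cEntry-shape true  false false false _   _   = refl
cEntry-shape false true  true  false _   _   = refl
cEntry-shape false true  false false _   _   = refl
cEntry-shape false false true  true  _   _   = refl
cEntry-shape false false true  false _   _   = refl
cEntry-shape false false false true  _   _   = refl
cEntry-shape false false false false _   _   = refl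

cEntry-δ : ∀ {k} {i j l : Fin k} → i ≢ j → j ≢ l → ∀ a b →
  cEntry (i , j , l) (a , b) ≡ δ a i * δ b j + δ a j * δ b l - δ a i * δ b l
cEntry-δ {i = i} {j} {l} i≢j j≢l a b = cEntry-shape (a ==ᶠ i) (b ==ᶠ j) (a ==ᶠ j) (b ==ᶠ l)
  (λ a==i a==j → i≢j (trans (sym (==ᶠ-sound a i a==i)) (==ᶠ-sound a j a==j)))
  (λ b==j b==l → j≢l (trans (sym (==ᶠ-sound b j b==j)) (==ᶠ-sound b l b==l)))

module _ (G : Graph) where

  isEdge : Fin (n G) → Fin (n G) → Bool
  isEdge i j = (i <ᶠ j) ∧ adj G i j

  closesTriangle : Fin (n G) → Fin (n G) → Fin (n G) → Bool
  closesTriangle i j k = (j <ᶠ k) ∧ adj G j k ∧ adj G i k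

  isTriangle : Fin (n G) → Fin (n G) → Fin (n G) → Bool
  isTriangle i j k = isEdge i j ∧ closesTriangle i j k

  τ : Fin (n G) → Fin (n G) → Fin (n G) → ℤ
  τ i j k = 𝟙 (isTriangle i j k)

  τ-unordered₁ : ∀ i j k → toℕ j ℕ.≤ toℕ i → τ i j k ≡ + 0
  τ-unordered₁ i j k j≤i = cong (λ b → 𝟙 ((b ∧ adj G i j) ∧ closesTriangle i j k)) (<ᵇ-false j≤i)

  τ-unordered₂ : ∀ i j k → toℕ k ℕ.≤ toℕ j → τ i j k ≡ + 0
  τ-unordered₂ i j k k≤j =
    cong 𝟙 (trans (cong (λ b → isEdge i j ∧ (b ∧ adj G j k ∧ adj G i k)) (<ᵇ-false k≤j))
                  (∧-zeroʳ (isEdge i j)))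

  sumℤ-Triangles : (f : Fin (n G) × Fin (n G) × Fin (n G) → ℤ) →
    sumℤ (map f (Triangles G)) ≡ ∑[ i < n G ] ∑[ j < n G ] ∑[ k < n G ] (τ i j k * f (i , j , k))
  sumℤ-Triangles f = begin
    sumℤ (map f (Triangles G))
      ≡⟨ sumℤ-concatMap f (λ i → concatMap (apexes i) (filterᵇ (isEdge i) (allFin (n G)))) (allFin (n G)) ⟩
    sumℤ (map (λ i → sumℤ (map f (concatMap (apexes i) (filterᵇ (isEdge i) (allFin (n G)))))) (allFin (n G)))
      ≡⟨ sumℤ-allFin (λ i → sumℤ (map f (concatMap (apexes i) (filterᵇ (isEdge i) (allFin (n G)))))) ⟩
    ∑[ i < n G ] sumℤ (map f (concatMap (apexes i) (filterᵇ (isEdge i) (allFin (n G)))))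
      ≡⟨ sum-cong-≗ from-tail ⟩
    ∑[ i < n G ] ∑[ j < n G ] ∑[ k < n G ] (τ i j k * f (i , j , k)) ∎
    where
    open ≡-Reasoning
    apexes : Fin (n G) → Fin (n G) → List (Fin (n G) × Fin (n G) × Fin (n G))
    apexes i j = map (λ k → (i , j , k)) (filterᵇ (closesTriangle i j) (allFin (n G)))
    over-apexes : ∀ i j → sumℤ (map f (apexes i j)) ≡ ∑[ k < n G ] (𝟙 (closesTriangle i j k) * f (i , j , k))
    over-apexes i j = trans (cong sumℤ (sym (ListP.map-∘ (filterᵇ (closesTriangle i j) (allFin (n G))))))
                            (sumℤ-filter-allFin (λ k → f (i , j , k)) (closesTriangle i j))
    split-τ : ∀ i j k → 𝟙 (isEdge i j) * (𝟙 (closesTriangle i j k) * f (i , j , k)) ≡ τ i j k * f (i , j , k)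
    split-τ i j k = trans (sym (ℤP.*-assoc (𝟙 (isEdge i j)) (𝟙 (closesTriangle i j k)) (f (i , j , k))))
                          (cong (_* f (i , j , k)) (sym (𝟙-∧ (isEdge i j) (closesTriangle i j k))))
    from-tail : ∀ i → sumℤ (map f (concatMap (apexes i) (filterᵇ (isEdge i) (allFin (n G)))))
                      ≡ ∑[ j < n G ] ∑[ k < n G ] (τ i j k * f (i , j , k))
    from-tail i = begin
      sumℤ (map f (concatMap (apexes i) (filterᵇ (isEdge i) (allFin (n G)))))
        ≡⟨ sumℤ-concatMap f (apexes i) (filterᵇ (isEdge i) (allFin (n G))) ⟩
      sumℤ (map (λ j → sumℤ (map f (apexes i j))) (filterᵇ (isEdge i) (allFin (n G))))
        ≡⟨ sumℤ-filter-allFin (λ j → sumℤ (map f (apexes i j))) (isEdge i) ⟩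
      ∑[ j < n G ] (𝟙 (isEdge i j) * sumℤ (map f (apexes i j)))
        ≡⟨ sum-cong-≗ (λ j → trans (cong (𝟙 (isEdge i j) *_) (over-apexes i j))
                                   (trans (*-distribˡ-sum (𝟙 (isEdge i j)) (λ k → 𝟙 (closesTriangle i j k) * f (i , j , k)))
                                          (sum-cong-≗ (split-τ i j)))) ⟩
      ∑[ j < n G ] ∑[ k < n G ] (τ i j k * f (i , j , k)) ∎

  τ-cEntry : ∀ i j k a b →
    τ i j k * cEntry (i , j , k) (a , b) ≡ τ i j k * (δ a i * δ b j + δ a j * δ b k - δ a i * δ b k)
  τ-cEntry i j k a b with isTriangle i j k in triangle
  ... | false = refl
  ... | true  = cong (+ 1 *_) (cEntry-δ (<⇒≢ (<ᵇ-sound i<j)) (<⇒≢ (<ᵇ-sound j<k)) a b)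
    where
    i<j : (i <ᶠ j) ≡ true
    i<j = ∧-trueˡ (∧-trueˡ triangle)
    j<k : (j <ᶠ k) ≡ true
    j<k = ∧-trueˡ (∧-trueʳ {isEdge i j} triangle)

  BBᵀ-entry CᵀC-entry helmholtzianEntry : Fin (n G) × Fin (n G) → Fin (n G) × Fin (n G) → ℤ
  BBᵀ-entry e f = sumℤ (map (λ v → bEntry e v * bEntry f v) (allFin (n G)))
  CᵀC-entry e f = sumℤ (map (λ T → cEntry T e * cEntry T f) (Triangles G))
  helmholtzianEntry e f = BBᵀ-entry e f + CᵀC-entry e f

  trianglesAbove trianglesBelow trianglesBetween : Fin (n G) → Fin (n G) → ℤ
  trianglesAbove   p q = ∑[ k < n G ] τ p q k
  trianglesBelow   p q = ∑[ i < n G ] τ i p q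
  trianglesBetween p q = ∑[ j < n G ] τ p j q

  BBᵀ-entry-δ : ∀ {p q u w} → p ≢ q → u ≢ w →
    BBᵀ-entry (p , q) (u , w) ≡ (δ w q - δ u q) - (δ w p - δ u p)
  BBᵀ-entry-δ {p} {q} {u} {w} p≢q u≢w = begin
    BBᵀ-entry (p , q) (u , w)
      ≡⟨ sumℤ-allFin (λ v → bEntry (p , q) v * bEntry (u , w) v) ⟩
    ∑[ v < n G ] (bEntry (p , q) v * bEntry (u , w) v)
      ≡⟨ sum-cong-≗ (λ v → trans (cong₂ _*_ (bEntry-δ p≢q v) (bEntry-δ u≢w v))
                                 (split (δ q v) (δ p v) (g v))) ⟩
    ∑[ v < n G ] (+ 1 * (δ q v * g v) + - + 1 * (δ p v * g v))
      ≡⟨ ∑-linear (+ 1) (- + 1) (λ v → δ q v * g v) (λ v → δ p v * g v) ⟩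
    + 1 * ∑[ v < n G ] (δ q v * g v) + - + 1 * ∑[ v < n G ] (δ p v * g v)
      ≡⟨ cong₂ (λ x y → + 1 * x + - + 1 * y) (∑-δ q g) (∑-δ p g) ⟩
    + 1 * g q + - + 1 * g p
      ≡⟨ unsplit (g q) (g p) ⟩
    g q - g p ∎
    where
    open ≡-Reasoning
    g : Fin (n G) → ℤ
    g v = δ w v - δ u v
    split : ∀ x y z → (x - y) * z ≡ + 1 * (x * z) + - + 1 * (y * z)
    split = solve-∀
    unsplit : ∀ x y → + 1 * x + - + 1 * y ≡ x - y
    unsplit = solve-∀

  triangleEntry : Fin (n G) × Fin (n G) → Fin (n G) → Fin (n G) → Fin (n G) → ℤ
  triangleEntry f i j k = τ i j k * cEntry (i , j , k) f

  CᵀC-entry-throughEdge : ∀ p q f →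
    CᵀC-entry (p , q) f ≡ ∑[ k < n G ] triangleEntry f p q k + ∑[ i < n G ] triangleEntry f i p q
                          - ∑[ j < n G ] triangleEntry f p j q
  CᵀC-entry-throughEdge p q f = begin
    CᵀC-entry (p , q) f
      ≡⟨ sumℤ-Triangles (λ T → cEntry T (p , q) * cEntry T f) ⟩
    ∑³ (λ i j k → τ i j k * (cEntry (i , j , k) (p , q) * cEntry (i , j , k) f))
      ≡⟨ sum-cong-≗ (λ i → sum-cong-≗ (λ j → sum-cong-≗ (λ k → expand i j k))) ⟩
    ∑³ (λ i j k → δ p i * (δ q j * X i j k) + δ p j * (δ q k * X i j k) - δ p i * (δ q k * X i j k))
      ≡⟨ ∑³-+- (λ i j k → δ p i * (δ q j * X i j k)) (λ i j k → δ p j * (δ q k * X i j k))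
               (λ i j k → δ p i * (δ q k * X i j k)) ⟩
    ∑³ (λ i j k → δ p i * (δ q j * X i j k)) + ∑³ (λ i j k → δ p j * (δ q k * X i j k))
      - ∑³ (λ i j k → δ p i * (δ q k * X i j k))
      ≡⟨ cong₂ _-_ (cong₂ _+_ edge-first edge-last) edge-long ⟩
    ∑[ k < N ] X p q k + ∑[ i < N ] X i p q - ∑[ j < N ] X p j q ∎
    where
    open ≡-Reasoning
    N : ℕ
    N = n G
    X : Fin N → Fin N → Fin N → ℤ
    X = triangleEntry f
    ∑³ : (Fin N → Fin N → Fin N → ℤ) → ℤ
    ∑³ F = ∑[ i < N ] ∑[ j < N ] ∑[ k < N ] F i j k
    ∑-+- : ∀ (f g h : Fin N → ℤ) → ∑[ i < N ] (f i + g i - h i) ≡ sum f + sum g - sum h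
    ∑-+- f g h = trans (∑-distrib-+ (λ i → f i + g i) (λ i → - h i)) (cong₂ _+_ (∑-distrib-+ f g) (∑-neg h))
    ∑³-+- : ∀ F G H → ∑³ (λ i j k → F i j k + G i j k - H i j k) ≡ ∑³ F + ∑³ G - ∑³ H
    ∑³-+- F G H = trans
      (sum-cong-≗ (λ i → trans (sum-cong-≗ (λ j → ∑-+- (F i j) (G i j) (H i j)))
                               (∑-+- (λ j → sum (F i j)) (λ j → sum (G i j)) (λ j → sum (H i j)))))
      (∑-+- (λ i → ∑[ j < N ] sum (F i j)) (λ i → ∑[ j < N ] sum (G i j)) (λ i → ∑[ j < N ] sum (H i j)))
    reorganise : ∀ t a b c d x →
      t * ((a * b + c * d - a * d) * x) ≡ a * (b * (t * x)) + c * (d * (t * x)) - a * (d * (t * x))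
    reorganise = solve-∀
    expand : ∀ i j k → τ i j k * (cEntry (i , j , k) (p , q) * cEntry (i , j , k) f)
                     ≡ δ p i * (δ q j * X i j k) + δ p j * (δ q k * X i j k) - δ p i * (δ q k * X i j k)
    expand i j k = begin
      τ i j k * (cEntry (i , j , k) (p , q) * cEntry (i , j , k) f)
        ≡⟨ ℤP.*-assoc (τ i j k) _ _ ⟨
      τ i j k * cEntry (i , j , k) (p , q) * cEntry (i , j , k) f
        ≡⟨ cong (_* cEntry (i , j , k) f) (τ-cEntry i j k p q) ⟩
      τ i j k * (δ p i * δ q j + δ p j * δ q k - δ p i * δ q k) * cEntry (i , j , k) f
        ≡⟨ ℤP.*-assoc (τ i j k) _ _ ⟩
      τ i j k * ((δ p i * δ q j + δ p j * δ q k - δ p i * δ q k) * cEntry (i , j , k) f)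
        ≡⟨ reorganise (τ i j k) (δ p i) (δ q j) (δ p j) (δ q k) (cEntry (i , j , k) f) ⟩
      δ p i * (δ q j * X i j k) + δ p j * (δ q k * X i j k) - δ p i * (δ q k * X i j k) ∎
    pull : ∀ a (h : Fin N → ℤ) → ∑[ r < N ] (a * h r) ≡ a * sum h
    pull a h = sym (*-distribˡ-sum a h)
    edge-first : ∑³ (λ i j k → δ p i * (δ q j * X i j k)) ≡ ∑[ k < N ] X p q k
    edge-first = begin
      ∑[ i < N ] ∑[ j < N ] ∑[ k < N ] (δ p i * (δ q j * X i j k))
        ≡⟨ sum-cong-≗ (λ i → sum-cong-≗ (λ j → trans (pull (δ p i) _) (cong (δ p i *_) (pull (δ q j) _)))) ⟩
      ∑[ i < N ] ∑[ j < N ] (δ p i * (δ q j * ∑[ k < N ] X i j k))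
        ≡⟨ sum-cong-≗ (λ i → trans (pull (δ p i) _) (cong (δ p i *_) (∑-δ q (λ j → ∑[ k < N ] X i j k)))) ⟩
      ∑[ i < N ] (δ p i * ∑[ k < N ] X i q k)
        ≡⟨ ∑-δ p (λ i → ∑[ k < N ] X i q k) ⟩
      ∑[ k < N ] X p q k ∎
    edge-last : ∑³ (λ i j k → δ p j * (δ q k * X i j k)) ≡ ∑[ i < N ] X i p q
    edge-last = sum-cong-≗ (λ i → begin
      ∑[ j < N ] ∑[ k < N ] (δ p j * (δ q k * X i j k))
        ≡⟨ sum-cong-≗ (λ j → trans (pull (δ p j) _) (cong (δ p j *_) (∑-δ q (X i j)))) ⟩
      ∑[ j < N ] (δ p j * X i j q)
        ≡⟨ ∑-δ p (λ j → X i j q) ⟩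
      X i p q ∎)
    edge-long : ∑³ (λ i j k → δ p i * (δ q k * X i j k)) ≡ ∑[ j < N ] X p j q
    edge-long = begin
      ∑[ i < N ] ∑[ j < N ] ∑[ k < N ] (δ p i * (δ q k * X i j k))
        ≡⟨ sum-cong-≗ (λ i → sum-cong-≗ (λ j → trans (pull (δ p i) _) (cong (δ p i *_) (∑-δ q (X i j))))) ⟩
      ∑[ i < N ] ∑[ j < N ] (δ p i * X i j q)
        ≡⟨ sum-cong-≗ (λ i → pull (δ p i) (λ j → X i j q)) ⟩
      ∑[ i < N ] (δ p i * ∑[ j < N ] X i j q)
        ≡⟨ ∑-δ p (λ i → ∑[ j < N ] X i j q) ⟩
      ∑[ j < N ] X p j q ∎

  ∑-triangleEntry-above : ∀ p q u w →
    ∑[ k < n G ] triangleEntry (u , w) p q k ≡ δ u p * δ w q * trianglesAbove p q + (δ u q - δ u p) * τ p q w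
  ∑-triangleEntry-above p q u w = begin
    ∑[ k < n G ] (τ p q k * cEntry (p , q , k) (u , w))
      ≡⟨ sum-cong-≗ (λ k → trans (τ-cEntry p q k u w) (reshape (τ p q k) (δ u p) (δ w q) (δ u q) (δ w k))) ⟩
    ∑[ k < n G ] (τ p q k * (δ u p * δ w q + δ u q * δ w k + - δ u p * δ w k))
      ≡⟨ ∑-collapse (τ p q) (δ u p * δ w q) (δ u q) (- δ u p) w w ⟩
    δ u p * δ w q * trianglesAbove p q + δ u q * τ p q w + - δ u p * τ p q w
      ≡⟨ regroup (δ u p * δ w q * trianglesAbove p q) (δ u q) (δ u p) (τ p q w) ⟩
    δ u p * δ w q * trianglesAbove p q + (δ u q - δ u p) * τ p q w ∎
    where
    open ≡-Reasoning
    reshape : ∀ t a b c d → t * (a * b + c * d - a * d) ≡ t * (a * b + c * d + - a * d)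
    reshape = solve-∀
    regroup : ∀ x a b t → x + a * t + - b * t ≡ x + (a - b) * t
    regroup = solve-∀

  ∑-triangleEntry-below : ∀ p q u w →
    ∑[ i < n G ] triangleEntry (u , w) i p q ≡ δ u p * δ w q * trianglesBelow p q + (δ w p - δ w q) * τ u p q
  ∑-triangleEntry-below p q u w = begin
    ∑[ i < n G ] (τ i p q * cEntry (i , p , q) (u , w))
      ≡⟨ sum-cong-≗ (λ i → trans (τ-cEntry i p q u w) (reshape (τ i p q) (δ u i) (δ w p) (δ u p) (δ w q))) ⟩
    ∑[ i < n G ] (τ i p q * (δ u p * δ w q + δ w p * δ u i + - δ w q * δ u i))
      ≡⟨ ∑-collapse (λ i → τ i p q) (δ u p * δ w q) (δ w p) (- δ w q) u u ⟩
    δ u p * δ w q * trianglesBelow p q + δ w p * τ u p q + - δ w q * τ u p q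
      ≡⟨ regroup (δ u p * δ w q * trianglesBelow p q) (δ w p) (δ w q) (τ u p q) ⟩
    δ u p * δ w q * trianglesBelow p q + (δ w p - δ w q) * τ u p q ∎
    where
    open ≡-Reasoning
    reshape : ∀ t a b c d → t * (a * b + c * d - a * d) ≡ t * (c * d + b * a + - d * a)
    reshape = solve-∀
    regroup : ∀ x a b t → x + a * t + - b * t ≡ x + (a - b) * t
    regroup = solve-∀

  ∑-triangleEntry-between : ∀ p q u w →
    ∑[ j < n G ] triangleEntry (u , w) p j q
      ≡ δ u p * τ p w q + δ w q * τ p u q - δ u p * δ w q * trianglesBetween p q
  ∑-triangleEntry-between p q u w = begin
    ∑[ j < n G ] (τ p j q * cEntry (p , j , q) (u , w))
      ≡⟨ sum-cong-≗ (λ j → trans (τ-cEntry p j q u w) (reshape (τ p j q) (δ u p) (δ w j) (δ u j) (δ w q))) ⟩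
    ∑[ j < n G ] (τ p j q * (- (δ u p * δ w q) + δ u p * δ w j + δ w q * δ u j))
      ≡⟨ ∑-collapse (λ j → τ p j q) (- (δ u p * δ w q)) (δ u p) (δ w q) w u ⟩
    - (δ u p * δ w q) * trianglesBetween p q + δ u p * τ p w q + δ w q * τ p u q
      ≡⟨ regroup (δ u p * δ w q) (trianglesBetween p q) (δ u p * τ p w q) (δ w q * τ p u q) ⟩
    δ u p * τ p w q + δ w q * τ p u q - δ u p * δ w q * trianglesBetween p q ∎
    where
    open ≡-Reasoning
    reshape : ∀ t a b c d → t * (a * b + c * d - a * d) ≡ t * (- (a * d) + a * b + d * c)
    reshape = solve-∀
    regroup : ∀ a K x y → - a * K + x + y ≡ x + y - a * K
    regroup = solve-∀

  -- The δ- and τ-values are passed as equations so that callers can plug in known values.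
  helmholtzianEntry-formula : ∀ {p q u w} → p ≢ q → u ≢ w →
    ∀ {up wp uq wq t₁ t₂ t₃ t₄} → δ u p ≡ up → δ w p ≡ wp → δ u q ≡ uq → δ w q ≡ wq →
    τ p q w ≡ t₁ → τ u p q ≡ t₂ → τ p w q ≡ t₃ → τ p u q ≡ t₄ →
    helmholtzianEntry (p , q) (u , w) ≡
      (wq - uq) - (wp - up)
      + (up * wq * trianglesAbove p q + (uq - up) * t₁
         + (up * wq * trianglesBelow p q + (wp - wq) * t₂)
         - (up * t₃ + wq * t₄ - up * wq * trianglesBetween p q))
  helmholtzianEntry-formula {p} {q} {u} {w} p≢q u≢w refl refl refl refl refl refl refl refl =
    cong₂ _+_ (BBᵀ-entry-δ p≢q u≢w)
      (trans (CᵀC-entry-throughEdge p q (u , w))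
             (cong₂ _-_ (cong₂ _+_ (∑-triangleEntry-above p q u w) (∑-triangleEntry-below p q u w))
                        (∑-triangleEntry-between p q u w)))

  helmholtzian-diagonal : ∀ {p q} → p ≢ q →
    helmholtzianEntry (p , q) (p , q) ≡ + 2 + (trianglesAbove p q + trianglesBelow p q + trianglesBetween p q)
  helmholtzian-diagonal {p} {q} p≢q = trans
    (helmholtzianEntry-formula p≢q p≢q (δ-refl p) (δ-≢ (p≢q ∘ sym)) (δ-≢ p≢q) (δ-refl q)
       (τ-unordered₂ p q q ℕP.≤-refl) (τ-unordered₁ p p q ℕP.≤-refl)
       (τ-unordered₂ p q q ℕP.≤-refl) (τ-unordered₁ p p q ℕP.≤-refl))
    (value (trianglesAbove p q) (trianglesBelow p q) (trianglesBetween p q))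
    where
    value : ∀ a b c → + 1 - + 0 - (+ 0 - + 1) + (+ 1 * + 1 * a + (+ 0 - + 1) * + 0
                        + (+ 1 * + 1 * b + (+ 0 - + 1) * + 0) - (+ 1 * + 0 + + 1 * + 0 - + 1 * + 1 * c))
                      ≡ + 2 + (a + b + c)
    value = solve-∀

  helmholtzian-sameTail : ∀ {p q w} → p ≢ q → p ≢ w → q ≢ w →
    helmholtzianEntry (p , q) (p , w) ≡ + 1 - τ p q w - τ p w q
  helmholtzian-sameTail {p} {q} {w} p≢q p≢w q≢w = trans
    (helmholtzianEntry-formula p≢q p≢w (δ-refl p) (δ-≢ (p≢w ∘ sym)) (δ-≢ p≢q) (δ-≢ (q≢w ∘ sym))
       refl (τ-unordered₁ p p q ℕP.≤-refl) refl (τ-unordered₁ p p q ℕP.≤-refl))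
    (value (trianglesAbove p q) (trianglesBelow p q) (trianglesBetween p q) (τ p q w) (τ p w q))
    where
    value : ∀ a b c t₁ t₃ → + 0 - + 0 - (+ 0 - + 1) + (+ 1 * + 0 * a + (+ 0 - + 1) * t₁
                              + (+ 1 * + 0 * b + (+ 0 - + 0) * + 0) - (+ 1 * t₃ + + 0 * + 0 - + 1 * + 0 * c))
                            ≡ + 1 - t₁ - t₃
    value = solve-∀

  helmholtzian-otherTail : ∀ {p q u w} → p ≢ q → u ≢ w → u ≢ p →
    helmholtzianEntry (p , q) (u , w)
      ≡ δ u q * (τ p q w - + 1) + δ w p * (τ u p q - + 1) + δ w q * (+ 1 - τ u p q - τ p u q)
  helmholtzian-otherTail {p} {q} {u} {w} p≢q u≢w u≢p = trans
    (helmholtzianEntry-formula p≢q u≢w (δ-≢ u≢p) refl refl refl refl refl refl refl)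
    (value (δ w q) (δ u q) (δ w p) (trianglesAbove p q) (trianglesBelow p q) (trianglesBetween p q)
           (τ p q w) (τ u p q) (τ p w q) (τ p u q))
    where
    value : ∀ wq uq wp a b c t₁ t₂ t₃ t₄ →
      wq - uq - (wp - + 0) + (+ 0 * wq * a + (uq - + 0) * t₁ + (+ 0 * wq * b + (wp - wq) * t₂)
                              - (+ 0 * t₃ + wq * t₄ - + 0 * wq * c))
        ≡ uq * (t₁ - + 1) + wp * (t₂ - + 1) + wq * (+ 1 - t₂ - t₄)
    value = solve-∀

  _≟ₑ_ : (e f : Fin (n G) × Fin (n G)) → Dec (e ≡ f)
  _≟ₑ_ = ≡-dec _≟_ _≟_

  charEntry : ℤ → Fin (n G) × Fin (n G) → Fin (n G) × Fin (n G) → ℤ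
  charEntry x e f = (if does (e ≟ₑ f) then x else + 0) - helmholtzianEntry e f

  charEntry-diagonal : ∀ x a → charEntry x a a ≡ x - helmholtzianEntry a a
  charEntry-diagonal x a = cong (λ b → (if b then x else + 0) - helmholtzianEntry a a) (dec-true (a ≟ₑ a) refl)

  charEntry-offDiagonal : ∀ x {a b} → a ≢ b → charEntry x a b ≡ + 0 - helmholtzianEntry a b
  charEntry-offDiagonal x {a} {b} a≢b =
    cong (λ c → (if c then x else + 0) - helmholtzianEntry a b) (dec-false (a ≟ₑ b) a≢b)

  tailBlock : Fin (n G) → List (Fin (n G) × Fin (n G))
  tailBlock i = map (i ,_) (filterᵇ (isEdge i) (allFin (n G)))

  ∈-tailBlock⁻ : ∀ {i a} → a ∈ tailBlock i → ∃ λ j → a ≡ (i , j) × isEdge i j ≡ true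
  ∈-tailBlock⁻ {i} a∈ with ∈-map⁻ (i ,_) a∈
  ... | j , j∈ , refl = j , refl , proj₂ (∈-filterᵇ⁻ (isEdge i) {allFin (n G)} j∈)

  Edges≡concat-tailBlock : Edges G ≡ concat (tabulate tailBlock)
  Edges≡concat-tailBlock = cong concat (ListP.map-tabulate id tailBlock)

  unique-tailBlock : ∀ i → Unique (tailBlock i)
  unique-tailBlock i = UniqueP.map⁺ (cong proj₂) (UniqueP.filter⁺ (T? ∘ isEdge i) (UniqueP.allFin⁺ (n G)))

  unique-Edges : Unique (Edges G)
  unique-Edges = subst Unique (sym Edges≡concat-tailBlock)
    (unique-concat-tabulate tailBlock (toℕ ∘ proj₁) unique-tailBlock tail-key)
    where
    tail-key : ∀ i {a} → a ∈ tailBlock i → toℕ (proj₁ a) ≡ toℕ i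
    tail-key i a∈ with ∈-tailBlock⁻ a∈
    ... | j , refl , _ = refl

  charPolyAt-Helmholtzian : ∀ x → charPolyAt (Helmholtzian G) x ≡ labelledDet (charEntry x) (Edges G)
  charPolyAt-Helmholtzian x = det-cong (λ r c → cong (λ b → (if b then x else + 0) - Helmholtzian G r c) (same-position r c))
    where
    same-position : ∀ r c → (r ==ᶠ c) ≡ does (lookup (Edges G) r ≟ₑ lookup (Edges G) c)
    same-position r c with r ≟ c
    ... | yes refl = trans (==ᶠ-refl r) (sym (dec-true (lookup (Edges G) r ≟ₑ lookup (Edges G) r) refl))
    ... | no r≢c   = trans (==ᶠ-≢ r≢c) (sym (dec-false (_ ≟ₑ _) (r≢c ∘ lookup-injective unique-Edges)))


-- The complete split graph K_t ∨ sK_1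

module _ (t s : ℕ) where

  private
    G : Graph
    G = completeSplit t s

  record Edge (p q : Fin (t ℕ.+ s)) : Set where
    constructor edge
    field
      ordered     : toℕ p ℕ.< toℕ q
      tail∈clique : toℕ p ℕ.< t
  open Edge

  adj-clique : ∀ {u v} → u ≢ v → toℕ u ℕ.< t ⊎ toℕ v ℕ.< t → adj G u v ≡ true
  adj-clique {u} {v} u≢v (inj₁ u<t) = cong₂ (λ a b → not a ∧ (b ∨ inClique {t} {s} v)) (==ᶠ-≢ u≢v) (<ᵇ-true u<t)
  adj-clique {u} {v} u≢v (inj₂ v<t) =
    cong₂ (λ a b → not a ∧ b) (==ᶠ-≢ u≢v) (trans (cong (inClique {t} {s} u ∨_) (<ᵇ-true v<t)) (∨-zeroʳ _))

  isEdge⇒Edge : ∀ p q → isEdge G p q ≡ true → Edge p q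
  isEdge⇒Edge p q e = edge p<q
    ([ <ᵇ-sound , (λ q∈ → ℕP.<-trans p<q (<ᵇ-sound q∈)) ]′
       (∨-true (∧-trueʳ {not (p ==ᶠ q)} (∧-trueʳ {p <ᶠ q} e))))
    where
    p<q : toℕ p ℕ.< toℕ q
    p<q = <ᵇ-sound (∧-trueˡ e)

  Edge⇒isEdge : ∀ {p q} → Edge p q → isEdge G p q ≡ true
  Edge⇒isEdge (edge p<q p<t) = cong₂ _∧_ (<ᵇ-true p<q) (adj-clique (<⇒≢ p<q) (inj₁ p<t))

  no-edge-fromIndependent : ∀ p q → t ℕ.≤ toℕ p → isEdge G p q ≡ false
  no-edge-fromIndependent p q t≤p with isEdge G p q in e
  ... | true  = contradiction (tail∈clique (isEdge⇒Edge p q e)) (ℕP.≤⇒≯ t≤p)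
  ... | false = refl

  triangle-middle∈clique : ∀ i j k → isTriangle G i j k ≡ true → toℕ j ℕ.< t
  triangle-middle∈clique i j k tri = tail∈clique (isEdge⇒Edge j k
    (cong₂ _∧_ (∧-trueˡ {j <ᶠ k} {adj G j k ∧ adj G i k} closes)
               (∧-trueˡ {adj G j k} {adj G i k} (∧-trueʳ {j <ᶠ k} {adj G j k ∧ adj G i k} closes))))
    where
    closes : closesTriangle G i j k ≡ true
    closes = ∧-trueʳ {isEdge G i j} {closesTriangle G i j k} tri

  τ-closed : ∀ i j k → toℕ i ℕ.< toℕ j → toℕ j ℕ.< toℕ k → toℕ j ℕ.< t → τ G i j k ≡ + 1
  τ-closed i j k i<j j<k j<t = cong 𝟙 (cong₂ _∧_ (Edge⇒isEdge (edge i<j i<t))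
    (cong₂ _∧_ (<ᵇ-true j<k) (cong₂ _∧_ (adj-clique (<⇒≢ j<k) (inj₁ j<t)) (adj-clique (<⇒≢ i<k) (inj₁ i<t)))))
    where
    i<t : toℕ i ℕ.< t
    i<t = ℕP.<-trans i<j j<t
    i<k : toℕ i ℕ.< toℕ k
    i<k = ℕP.<-trans i<j j<k

  τ-independentMiddle : ∀ i j k → t ℕ.≤ toℕ j → τ G i j k ≡ + 0
  τ-independentMiddle i j k t≤j with isTriangle G i j k in tri
  ... | true  = contradiction (triangle-middle∈clique i j k tri) (ℕP.≤⇒≯ t≤j)
  ... | false = refl

  trianglesBelow-edge : ∀ {p q} → Edge p q → trianglesBelow G p q ≡ + toℕ p
  trianglesBelow-edge {p} {q} e = trans (sym (ℤP.+-identityʳ _))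
    (∑-interval 0 (toℕ p) (λ i → τ G i p q) ℕ.z≤n (ℕP.<⇒≤ (FinP.toℕ<n p)) (λ _ ())
      (λ i _ i<p → τ-closed i p q i<p (ordered e) (tail∈clique e)) (λ i p≤i → τ-unordered₁ G i p q p≤i))

  trianglesAbove-cliqueEdge : ∀ {p q} → Edge p q → toℕ q ℕ.< t →
    trianglesAbove G p q + + suc (toℕ q) ≡ + (t ℕ.+ s)
  trianglesAbove-cliqueEdge {p} {q} e q<t =
    ∑-interval (suc (toℕ q)) (t ℕ.+ s) (τ G p q) (FinP.toℕ<n q) ℕP.≤-refl
      (λ k k≤q → τ-unordered₂ G p q k (ℕ.s≤s⁻¹ k≤q)) (λ k q<k _ → τ-closed p q k (ordered e) q<k q<t)
      (λ k N≤k → contradiction (FinP.toℕ<n k) (ℕP.≤⇒≯ N≤k))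

  trianglesAbove-crossEdge : ∀ {p q} → t ℕ.≤ toℕ q → trianglesAbove G p q ≡ + 0
  trianglesAbove-crossEdge {p} {q} t≤q = ∑-zero (λ k → τ-independentMiddle p q k t≤q)

  trianglesBetween-cliqueEdge : ∀ {p q} → Edge p q → toℕ q ℕ.< t →
    trianglesBetween G p q + + suc (toℕ p) ≡ + toℕ q
  trianglesBetween-cliqueEdge {p} {q} e q<t =
    ∑-interval (suc (toℕ p)) (toℕ q) (λ j → τ G p j q) (ordered e) (ℕP.<⇒≤ (FinP.toℕ<n q))
      (λ j j≤p → τ-unordered₁ G p j q (ℕ.s≤s⁻¹ j≤p)) (λ j p<j j<q → τ-closed p j q p<j j<q (ℕP.<-trans j<q q<t))
      (λ j q≤j → τ-unordered₂ G p j q q≤j)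

  trianglesBetween-crossEdge : ∀ {p q} → Edge p q → t ℕ.≤ toℕ q →
    trianglesBetween G p q + + suc (toℕ p) ≡ + t
  trianglesBetween-crossEdge {p} {q} e t≤q =
    ∑-interval (suc (toℕ p)) t (λ j → τ G p j q) (tail∈clique e) (ℕP.m≤m+n t s)
      (λ j j≤p → τ-unordered₁ G p j q (ℕ.s≤s⁻¹ j≤p)) (λ j p<j j<t → τ-closed p j q p<j (ℕP.<-≤-trans j<t t≤q) j<t)
      (λ j t≤j → τ-independentMiddle p j q t≤j)
  helmholtzian-cliqueEdge : ∀ {p q} → Edge p q → toℕ q ℕ.< t →
    helmholtzianEntry G (p , q) (p , q) ≡ + (t ℕ.+ s)
  helmholtzian-cliqueEdge {p} {q} e q<t = begin
    helmholtzianEntry G (p , q) (p , q)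
      ≡⟨ helmholtzian-diagonal G (<⇒≢ (ordered e)) ⟩
    + 2 + (trianglesAbove G p q + trianglesBelow G p q + trianglesBetween G p q)
      ≡⟨ regroup (trianglesAbove G p q) (trianglesBelow G p q) (trianglesBetween G p q) (+ toℕ q) ⟩
    (trianglesAbove G p q + + suc (toℕ q)) + (trianglesBetween G p q + (+ 1 + trianglesBelow G p q)) - + toℕ q
      ≡⟨ cong₂ (λ a b → a + b - + toℕ q) (trianglesAbove-cliqueEdge e q<t)
           (trans (cong (λ b → trianglesBetween G p q + (+ 1 + b)) (trianglesBelow-edge e))
                  (trianglesBetween-cliqueEdge e q<t)) ⟩
    + (t ℕ.+ s) + + toℕ q - + toℕ q
      ≡⟨ cancel (+ (t ℕ.+ s)) (+ toℕ q) ⟩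
    + (t ℕ.+ s) ∎
    where
    open ≡-Reasoning
    regroup : ∀ a b c q → + 2 + (a + b + c) ≡ (a + (+ 1 + q)) + (c + (+ 1 + b)) - q
    regroup = solve-∀
    cancel : ∀ n q → n + q - q ≡ n
    cancel = solve-∀

  helmholtzian-crossEdge : ∀ {p q} → Edge p q → t ℕ.≤ toℕ q →
    helmholtzianEntry G (p , q) (p , q) ≡ + 1 + + t
  helmholtzian-crossEdge {p} {q} e t≤q = begin
    helmholtzianEntry G (p , q) (p , q)
      ≡⟨ helmholtzian-diagonal G (<⇒≢ (ordered e)) ⟩
    + 2 + (trianglesAbove G p q + trianglesBelow G p q + trianglesBetween G p q)
      ≡⟨ cong (λ a → + 2 + (a + trianglesBelow G p q + trianglesBetween G p q)) (trianglesAbove-crossEdge t≤q) ⟩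
    + 2 + (+ 0 + trianglesBelow G p q + trianglesBetween G p q)
      ≡⟨ regroup (trianglesBelow G p q) (trianglesBetween G p q) ⟩
    + 1 + (trianglesBetween G p q + (+ 1 + trianglesBelow G p q))
      ≡⟨ cong (λ b → + 1 + (trianglesBetween G p q + (+ 1 + b))) (trianglesBelow-edge e) ⟩
    + 1 + (trianglesBetween G p q + + suc (toℕ p))
      ≡⟨ cong (_+_ (+ 1)) (trianglesBetween-crossEdge e t≤q) ⟩
    + 1 + + t ∎
    where
    open ≡-Reasoning
    regroup : ∀ b c → + 2 + (+ 0 + b + c) ≡ + 1 + (c + (+ 1 + b))
    regroup = solve-∀

  helmholtzian-sameTail-clique : ∀ {p q w} → Edge p q → Edge p w → q ≢ w →
    toℕ q ℕ.< t ⊎ toℕ w ℕ.< t → helmholtzianEntry G (p , q) (p , w) ≡ + 0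
  helmholtzian-sameTail-clique {p} {q} {w} e₁ e₂ q≢w one-in-clique =
    trans (helmholtzian-sameTail G (<⇒≢ (ordered e₁)) (<⇒≢ (ordered e₂)) q≢w) (by-order (toℕ q ℕ.<? toℕ w))
    where
    by-order : Dec (toℕ q ℕ.< toℕ w) → + 1 - τ G p q w - τ G p w q ≡ + 0
    by-order (yes q<w) = cong₂ (λ a b → + 1 - a - b)
      (τ-closed p q w (ordered e₁) q<w ([ id , ℕP.<-trans q<w ]′ one-in-clique))
      (τ-unordered₂ G p w q (ℕP.<⇒≤ q<w))
    by-order (no q≮w) = cong₂ (λ a b → + 1 - a - b)
      (τ-unordered₂ G p q w (ℕP.≮⇒≥ q≮w))
      (τ-closed p w q (ordered e₂) w<q ([ ℕP.<-trans w<q , id ]′ one-in-clique))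
      where
      w<q : toℕ w ℕ.< toℕ q
      w<q = ℕP.≤∧≢⇒< (ℕP.≮⇒≥ q≮w) (q≢w ∘ sym ∘ FinP.toℕ-injective)

  helmholtzian-sameTail-independent : ∀ {p q w} → Edge p q → Edge p w → q ≢ w →
    t ℕ.≤ toℕ q → t ℕ.≤ toℕ w → helmholtzianEntry G (p , q) (p , w) ≡ + 1
  helmholtzian-sameTail-independent {p} {q} {w} e₁ e₂ q≢w t≤q t≤w =
    trans (helmholtzian-sameTail G (<⇒≢ (ordered e₁)) (<⇒≢ (ordered e₂)) q≢w)
          (cong₂ (λ a b → + 1 - a - b) (τ-independentMiddle p q w t≤q) (τ-independentMiddle p w q t≤w))

  helmholtzian-otherTail-zero : ∀ {p q u w} → Edge p q → Edge u w → u ≢ p →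
    helmholtzianEntry G (p , q) (u , w) ≡ + 0
  helmholtzian-otherTail-zero {p} {q} {u} {w} e₁ e₂ u≢p =
    trans (helmholtzian-otherTail G (<⇒≢ (ordered e₁)) (<⇒≢ (ordered e₂)) u≢p)
          (cong₂ _+_ (cong₂ _+_ (δ-vanish head-is-tail) (δ-vanish tail-is-tail)) (δ-vanish same-head))
    where
    head-is-tail : u ≡ q → τ G p q w - + 1 ≡ + 0
    head-is-tail refl = cong (_- + 1) (τ-closed p q w (ordered e₁) (ordered e₂) (tail∈clique e₂))
    tail-is-tail : w ≡ p → τ G u p q - + 1 ≡ + 0
    tail-is-tail refl = cong (_- + 1) (τ-closed u p q (ordered e₂) (ordered e₁) (tail∈clique e₁))
    same-head : w ≡ q → + 1 - τ G u p q - τ G p u q ≡ + 0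
    same-head refl with toℕ u ℕ.<? toℕ p
    ... | yes u<p = cong₂ (λ a b → + 1 - a - b)
      (τ-closed u p w u<p (ordered e₁) (tail∈clique e₁)) (τ-unordered₁ G p u w (ℕP.<⇒≤ u<p))
    ... | no u≮p = cong₂ (λ a b → + 1 - a - b)
      (τ-unordered₁ G u p w (ℕP.≮⇒≥ u≮p)) (τ-closed p u w p<u (ordered e₂) (tail∈clique e₂))
      where
      p<u : toℕ p ℕ.< toℕ u
      p<u = ℕP.≤∧≢⇒< (ℕP.≮⇒≥ u≮p) (u≢p ∘ sym ∘ FinP.toℕ-injective)

  charEntry-crossBlock : ∀ X {p p′ a b} → p ≢ p′ → a ∈ tailBlock G p → b ∈ tailBlock G p′ →
                         charEntry G X a b ≡ + 0
  charEntry-crossBlock X {p} {p′} p≢p′ a∈ b∈ with ∈-tailBlock⁻ G a∈ | ∈-tailBlock⁻ G b∈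
  ... | q , refl , e | q′ , refl , e′ = trans (charEntry-offDiagonal G X (p≢p′ ∘ cong proj₁))
    (cong (_-_ (+ 0)) (helmholtzian-otherTail-zero (isEdge⇒Edge p q e) (isEdge⇒Edge p′ q′ e′) (p≢p′ ∘ sym)))

  heads cliqueHeads crossHeads : Fin (t ℕ.+ s) → List (Fin (t ℕ.+ s))
  heads       p = filterᵇ (isEdge G p) (allFin (t ℕ.+ s))
  cliqueHeads p = filterᵇ (inClique {t} {s}) (heads p)
  crossHeads  p = filterᵇ (not ∘ inClique {t} {s}) (heads p)

  cliqueEdges crossEdges : Fin (t ℕ.+ s) → List (Fin (t ℕ.+ s) × Fin (t ℕ.+ s))
  cliqueEdges p = map (p ,_) (cliqueHeads p)
  crossEdges  p = map (p ,_) (crossHeads p)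

  tailBlock-split : ∀ p → tailBlock G p ≡ cliqueEdges p ++ crossEdges p
  tailBlock-split p = trans (cong (map (p ,_)) (sym (filterᵇ-partition (inClique {t} {s}) clique-first)))
                            (ListP.map-++ (p ,_) (cliqueHeads p) (crossHeads p))
    where
    clique-first : AllPairs (λ a b → inClique {t} {s} b ≡ true → inClique {t} {s} a ≡ true) (heads p)
    clique-first = AllPairs.map (λ a<b b<t → <ᵇ-true (ℕP.<-trans a<b (<ᵇ-sound {n = t} b<t)))
                                (AllPairsP.filter⁺ (T? ∘ isEdge G p) (allFin-sorted (t ℕ.+ s)))

  ∈-heads⁻ : ∀ {p q} → q ∈ heads p → Edge p q
  ∈-heads⁻ {p} {q} q∈ = isEdge⇒Edge p q (proj₂ (∈-filterᵇ⁻ (isEdge G p) {allFin (t ℕ.+ s)} q∈))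

  ∈-cliqueEdges⁻ : ∀ {p a} → a ∈ cliqueEdges p → ∃ λ q → a ≡ (p , q) × Edge p q × toℕ q ℕ.< t
  ∈-cliqueEdges⁻ {p} a∈ with ∈-map⁻ (p ,_) a∈
  ... | q , q∈ , refl with ∈-filterᵇ⁻ (inClique {t} {s}) {heads p} q∈
  ...   | q∈heads , q<t = q , refl , ∈-heads⁻ q∈heads , <ᵇ-sound {toℕ q} {t} q<t

  ∈-crossEdges⁻ : ∀ {p a} → a ∈ crossEdges p → ∃ λ q → a ≡ (p , q) × Edge p q × t ℕ.≤ toℕ q
  ∈-crossEdges⁻ {p} a∈ with ∈-map⁻ (p ,_) a∈
  ... | q , q∈ , refl with ∈-filterᵇ⁻ (not ∘ inClique {t} {s}) {heads p} q∈
  ...   | q∈heads , q∉clique = q , refl , ∈-heads⁻ q∈heads ,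
          ℕP.≮⇒≥ (λ q<t → contradiction (trans (sym (cong not (<ᵇ-true q<t))) q∉clique) (λ ()))

  unique-headsPart : ∀ p (P : Fin (t ℕ.+ s) → Bool) → Unique (map (p ,_) (filterᵇ P (heads p)))
  unique-headsPart p P = UniqueP.map⁺ (cong proj₂)
    (UniqueP.filter⁺ (T? ∘ P) (UniqueP.filter⁺ (T? ∘ isEdge G p) (UniqueP.allFin⁺ (t ℕ.+ s))))

  length-cliqueHeads : ∀ {p} → toℕ p ℕ.< t → + length (cliqueHeads p) + + suc (toℕ p) ≡ + t
  length-cliqueHeads {p} p<t =
    trans (cong (_+ + suc (toℕ p)) (length-filter-filter (isEdge G p) (inClique {t} {s})))
      (∑-interval (suc (toℕ p)) t _ p<t (ℕP.m≤m+n t s)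
        (λ q q≤p → cong (λ b → 𝟙 (b ∧ adj G p q) * 𝟙 (inClique {t} {s} q)) (<ᵇ-false (ℕ.s≤s⁻¹ q≤p)))
        (λ q p<q q<t → cong₂ (λ a b → 𝟙 a * 𝟙 b) (Edge⇒isEdge (edge p<q p<t)) (<ᵇ-true q<t))
        (λ q t≤q → cong₂ (λ a b → 𝟙 a * 𝟙 b) (Edge⇒isEdge (edge (ℕP.<-≤-trans p<t t≤q) p<t)) (<ᵇ-false t≤q)))

  length-crossHeads : ∀ {p} → toℕ p ℕ.< t → + length (crossHeads p) + + t ≡ + (t ℕ.+ s)
  length-crossHeads {p} p<t =
    trans (cong (_+ + t) (length-filter-filter (isEdge G p) (not ∘ inClique {t} {s})))
      (∑-interval t (t ℕ.+ s) _ (ℕP.m≤m+n t s) ℕP.≤-refl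
        (λ q q<t → trans (cong (λ b → 𝟙 (isEdge G p q) * 𝟙 (not b)) (<ᵇ-true q<t))
                         (ℤP.*-zeroʳ (𝟙 (isEdge G p q))))
        (λ q t≤q _ → cong₂ (λ a b → 𝟙 a * 𝟙 (not b))
                           (Edge⇒isEdge (edge (ℕP.<-≤-trans p<t t≤q) p<t)) (<ᵇ-false t≤q))
        (λ q N≤q → contradiction (FinP.toℕ<n q) (ℕP.≤⇒≯ N≤q)))

[2+u]C2≡1+u+[1+u]C2 : ∀ u → (suc u ℕ.+ 1) C 2 ≡ suc u ℕ.+ (u ℕ.+ 1) C 2
[2+u]C2≡1+u+[1+u]C2 u = trans (sym (nCk+nC[k+1]≡[n+1]C[k+1] (u ℕ.+ 1) 1))
                              (cong (ℕ._+ (u ℕ.+ 1) C 2) (trans (nC1≡n (u ℕ.+ 1)) (ℕP.+-comm u 1)))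

module _ (t s′ : ℕ) (X : ℤ) where

  private
    s N : ℕ
    s = suc s′
    N = t ℕ.+ s
    G : Graph
    G = completeSplit t s
    Z W : ℤ
    Z = X - + N
    W = (X - + t) ^ s′
    charDet : List (Fin N × Fin N) → ℤ
    charDet = labelledDet (charEntry G X)

  blockFactor : ℕ → ℕ → ℤ
  blockFactor u m = if m ℕ.<ᵇ u then Z ^ (u ∸ m) * W else + 1

  cliqueEdges-det : ∀ p → charDet (cliqueEdges t s p) ≡ Z ^ length (cliqueHeads t s p)
  cliqueEdges-det p = begin
    charDet (cliqueEdges t s p)
      ≡⟨ labelledDet-uniform (charEntry G X) (unique-headsPart t s p (inClique {t} {s}))
           (λ b → if b then Z else + 0) diagonal off-diagonal ⟩
    det (length (cliqueEdges t s p)) (scalar Z)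
      ≡⟨ det-scalar (length (cliqueEdges t s p)) Z ⟩
    Z ^ length (cliqueEdges t s p)
      ≡⟨ cong (Z ^_) (ListP.length-map (p ,_) (cliqueHeads t s p)) ⟩
    Z ^ length (cliqueHeads t s p) ∎
    where
    open ≡-Reasoning
    diagonal : ∀ {a} → a ∈ cliqueEdges t s p → charEntry G X a a ≡ Z
    diagonal a∈ with ∈-cliqueEdges⁻ t s a∈
    ... | q , refl , e , q<t =
      trans (charEntry-diagonal G X (p , q)) (cong (_-_ X) (helmholtzian-cliqueEdge t s e q<t))
    off-diagonal : ∀ {a b} → a ∈ cliqueEdges t s p → b ∈ cliqueEdges t s p → a ≢ b → charEntry G X a b ≡ + 0
    off-diagonal a∈ b∈ a≢b with ∈-cliqueEdges⁻ t s a∈ | ∈-cliqueEdges⁻ t s b∈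
    ... | q , refl , e , q<t | q′ , refl , e′ , _ = trans (charEntry-offDiagonal G X a≢b)
          (cong (_-_ (+ 0)) (helmholtzian-sameTail-clique t s e e′ (a≢b ∘ cong (p ,_)) (inj₁ q<t)))

  crossEdges-det : ∀ {p} → toℕ p ℕ.< t → charDet (crossEdges t s p) ≡ (X - + t - + s) * (X - + t) ^ s′
  crossEdges-det {p} p<t = begin
    charDet (crossEdges t s p)
      ≡⟨ labelledDet-uniform (charEntry G X) (unique-headsPart t s p (not ∘ inClique {t} {s}))
           (λ b → (if b then X - + t else + 0) - + 1) diagonal off-diagonal ⟩
    det (length (crossEdges t s p)) (scalarMinusOnes (X - + t))
      ≡⟨ cong (λ m → det m (scalarMinusOnes (X - + t))) length≡s ⟩
    det s (scalarMinusOnes (X - + t))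
      ≡⟨ det-scalarMinusOnes s′ (X - + t) ⟩
    (X - + t - + s) * (X - + t) ^ s′ ∎
    where
    open ≡-Reasoning
    length≡s : length (crossEdges t s p) ≡ s
    length≡s = trans (ListP.length-map (p ,_) (crossHeads t s p))
      (ℕP.+-cancelˡ-≡ t _ s (trans (ℕP.+-comm t _) (ℤP.+-injective (length-crossHeads t s p<t))))
    shift : ∀ X t → X - (+ 1 + t) ≡ X - t - + 1
    shift = solve-∀
    diagonal : ∀ {a} → a ∈ crossEdges t s p → charEntry G X a a ≡ X - + t - + 1
    diagonal a∈ with ∈-crossEdges⁻ t s a∈
    ... | q , refl , e , t≤q = trans (charEntry-diagonal G X (p , q))
          (trans (cong (_-_ X) (helmholtzian-crossEdge t s e t≤q)) (shift X (+ t)))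
    off-diagonal : ∀ {a b} → a ∈ crossEdges t s p → b ∈ crossEdges t s p → a ≢ b → charEntry G X a b ≡ + 0 - + 1
    off-diagonal a∈ b∈ a≢b with ∈-crossEdges⁻ t s a∈ | ∈-crossEdges⁻ t s b∈
    ... | q , refl , e , t≤q | q′ , refl , e′ , t≤q′ = trans (charEntry-offDiagonal G X a≢b)
          (cong (_-_ (+ 0)) (helmholtzian-sameTail-independent t s e e′ (a≢b ∘ cong (p ,_)) t≤q t≤q′))

  tailBlock-det : ∀ p → charDet (tailBlock G p) ≡ blockFactor t (toℕ p)
  tailBlock-det p with toℕ p ℕ.<? t
  ... | no p≮t = begin
    charDet (map (p ,_) (heads t s p))
      ≡⟨ cong (charDet ∘ map (p ,_))
           (filterᵇ-none (isEdge G p) (AllP.tabulate⁺ (λ q → no-edge-fromIndependent t s p q (ℕP.≮⇒≥ p≮t)))) ⟩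
    + 1
      ≡⟨ cong (λ b → if b then Z ^ (t ∸ toℕ p) * W else + 1) (<ᵇ-false (ℕP.≮⇒≥ p≮t)) ⟨
    blockFactor t (toℕ p) ∎
    where open ≡-Reasoning
  ... | yes p<t = begin
    charDet (tailBlock G p)
      ≡⟨ cong charDet (tailBlock-split t s p) ⟩
    charDet (cliqueEdges t s p ++ crossEdges t s p)
      ≡⟨ labelledDet-++ (charEntry G X) (cliqueEdges t s p) (crossEdges t s p) between ⟩
    charDet (cliqueEdges t s p) * charDet (crossEdges t s p)
      ≡⟨ cong₂ _*_ (cliqueEdges-det p) (crossEdges-det p<t) ⟩
    Z ^ length (cliqueHeads t s p) * ((X - + t - + s) * W)
      ≡⟨ cong (λ z → Z ^ length (cliqueHeads t s p) * (z * W)) (split-N X (+ t) (+ s)) ⟩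
    Z ^ length (cliqueHeads t s p) * (Z * W)
      ≡⟨ regroup (Z ^ length (cliqueHeads t s p)) Z W ⟩
    Z ^ suc (length (cliqueHeads t s p)) * W
      ≡⟨ cong (λ e → Z ^ e * W) exponent ⟨
    Z ^ (t ∸ toℕ p) * W
      ≡⟨ cong (λ b → if b then Z ^ (t ∸ toℕ p) * W else + 1) (<ᵇ-true p<t) ⟨
    blockFactor t (toℕ p) ∎
    where
    open ≡-Reasoning
    split-N : ∀ X t s → X - t - s ≡ X - (t + s)
    split-N = solve-∀
    regroup : ∀ a z w → a * (z * w) ≡ z * a * w
    regroup = solve-∀
    exponent : t ∸ toℕ p ≡ suc (length (cliqueHeads t s p))
    exponent = begin
      t ∸ toℕ p
        ≡⟨ cong (_∸ toℕ p) (ℤP.+-injective (length-cliqueHeads t s p<t)) ⟨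
      (length (cliqueHeads t s p) ℕ.+ suc (toℕ p)) ∸ toℕ p
        ≡⟨ cong (_∸ toℕ p) (ℕP.+-suc (length (cliqueHeads t s p)) (toℕ p)) ⟩
      (suc (length (cliqueHeads t s p)) ℕ.+ toℕ p) ∸ toℕ p
        ≡⟨ ℕP.m+n∸n≡m (suc (length (cliqueHeads t s p))) (toℕ p) ⟩
      suc (length (cliqueHeads t s p)) ∎
    between : ∀ {a b} → a ∈ cliqueEdges t s p → b ∈ crossEdges t s p → charEntry G X a b ≡ + 0
    between a∈ b∈ with ∈-cliqueEdges⁻ t s a∈ | ∈-crossEdges⁻ t s b∈
    ... | q , refl , e , q<t | q′ , refl , e′ , t≤q′ = trans (charEntry-offDiagonal G X (q≢q′ ∘ cong proj₂))
          (cong (_-_ (+ 0)) (helmholtzian-sameTail-clique t s e e′ q≢q′ (inj₁ q<t)))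
      where
      q≢q′ : q ≢ q′
      q≢q′ refl = ℕP.<⇒≱ q<t t≤q′

  ∏-blockFactor : ∀ u {n} → u ℕ.≤ n → ∏ {n} (λ p → blockFactor u (toℕ p)) ≡ Z ^ ((u ℕ.+ 1) C 2) * W ^ u
  ∏-blockFactor zero    {n}     _   = ∏-ones n
  ∏-blockFactor (suc u) {suc n} u<n = begin
    Z ^ suc u * W * ∏ {n} (λ p → blockFactor u (toℕ p))
      ≡⟨ cong (Z ^ suc u * W *_) (∏-blockFactor u (ℕ.s≤s⁻¹ u<n)) ⟩
    Z ^ suc u * W * (Z ^ ((u ℕ.+ 1) C 2) * W ^ u)
      ≡⟨ regroup (Z ^ suc u) W (Z ^ ((u ℕ.+ 1) C 2)) (W ^ u) ⟩
    Z ^ suc u * Z ^ ((u ℕ.+ 1) C 2) * (W * W ^ u)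
      ≡⟨ cong (_* (W * W ^ u)) (ℤP.^-distribˡ-+-* Z (suc u) ((u ℕ.+ 1) C 2)) ⟨
    Z ^ (suc u ℕ.+ (u ℕ.+ 1) C 2) * W ^ suc u
      ≡⟨ cong (λ e → Z ^ e * W ^ suc u) ([2+u]C2≡1+u+[1+u]C2 u) ⟨
    Z ^ ((suc u ℕ.+ 1) C 2) * W ^ suc u ∎
    where
    open ≡-Reasoning
    regroup : ∀ a w b v → a * w * (b * v) ≡ a * b * (w * v)
    regroup = solve-∀

  charPolyAt-completeSplit : charPolyAt (Helmholtzian G) X ≡ Z ^ ((t ℕ.+ 1) C 2) * W ^ t
  charPolyAt-completeSplit = begin
    charPolyAt (Helmholtzian G) X
      ≡⟨ charPolyAt-Helmholtzian G X ⟩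
    charDet (Edges G)
      ≡⟨ cong charDet (Edges≡concat-tailBlock G) ⟩
    charDet (concat (tabulate (tailBlock G)))
      ≡⟨ labelledDet-concat (charEntry G X) (tailBlock G) (charEntry-crossBlock t s X) ⟩
    ∏ (charDet ∘ tailBlock G)
      ≡⟨ ∏-cong {N} tailBlock-det ⟩
    ∏ {N} (λ p → blockFactor t (toℕ p))
      ≡⟨ ∏-blockFactor t (ℕP.m≤m+n t s) ⟩
    Z ^ ((t ℕ.+ 1) C 2) * W ^ t ∎
    where open ≡-Reasoning

corollary3p8 : (t s : ℕ) → 1 ≤ t → 2 ≤ s → (x : ℤ) →
    charPolyAt (Helmholtzian (completeSplit t s)) x
      ≡ ((x - + (s +ℕ t)) ^ ((t +ℕ 1) C 2)) * ((x - + t) ^ ((s ∸ 1) *ℕ t))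
corollary3p8 t (suc s′) _ (ℕ.s≤s _) x = begin
  charPolyAt (Helmholtzian (completeSplit t (suc s′))) x
    ≡⟨ charPolyAt-completeSplit t s′ x ⟩
  (x - + (t ℕ.+ suc s′)) ^ ((t ℕ.+ 1) C 2) * ((x - + t) ^ s′) ^ t
    ≡⟨ cong₂ (λ n p → (x - + n) ^ ((t ℕ.+ 1) C 2) * p) (ℕP.+-comm t (suc s′)) (ℤP.^-*-assoc (x - + t) s′ t) ⟩
  (x - + (suc s′ ℕ.+ t)) ^ ((t ℕ.+ 1) C 2) * (x - + t) ^ (s′ ℕ.* t) ∎
  where open ≡-Reasoning
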